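{- Let $G$ be a connected undirected graph with $m$ edges, let $S=\langle s_1,\dots,s_k\rangle$ be a bounce sequence, and let $w>0$. Then $$Z_R(G\otimes B_S;w)=C_S^m\cdot Z_R(G;w_S),$$ where $$\frac{1}{w_S}=\sum_{i=1}^k\frac{1}{(1+w/s_i)^i-1}\quad\text{and}\quad C_S=\frac{1}{w_S}\prod_{i=1}^k w^{(s_i-1)i}\big((w+s_i)^i-s_i^i\big).$$
   Context: For a connected undirected (multi)graph $G=(V,E)$ and a constant edge weight $w$, $Z_R(G;w)=\sum_{A\subseteq E,\ (V,A)\text{ connected}} w^{|A|}$. For positive integers $h,l$, the $(h,l)$-bounce is the two-terminal graph obtained from $h$ vertex-disjoint simple paths of length $l$ (i.e. $l$ edges) by identifying all their left endpoints into one terminal and all their right endpoints into the other. A bounce sequence is a sequence $S=\langle s_1,\dots,s_k\rangle$ of integers $s_i>1$; the bounce graph $B_S$ is the two-terminal graph obtained by concatenating (identifying the right terminal of each with the left terminal of the next) the $(i,s_i)$-bounces for $i=1,\dots,k$, its terminals being the left terminal of the first and the right terminal of the last bounce. For a two-terminal graph $H$, the $H$-inflation $G\otimes H$ is obtained from $G$ by replacing every edge $xy$ by a fresh copy of $H$, identifying $x$ with one terminal and $y$ with the other.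
   Formalization: The edge weight w ranges over the positive rationals instead of the positive reals. -}

module Defs where

open import Data.Nat as ℕ using (ℕ; zero; suc)
open import Data.Integer using (+_)
open import Data.Rational using (ℚ; 0ℚ; 1ℚ; _+_; _*_; _-_; _/_; 1/_)
open import Data.Rational.Properties using (_≟_)
import Data.Rational.Base as ℚB
open import Data.Fin using (Fin; zero; suc; _↑ˡ_; _↑ʳ_; combine; remQuot; splitAt; inject₁)
open import Data.Fin.Properties using (any?)
open import Data.Fin.Subset using (Subset; _∈_; _∉_; ∣_∣; inside; outside; ⊤)
open import Data.Fin.Subset.Properties using (_∈?_; anySubset?)
open import Data.Product using (_×_; _,_; ∃; proj₁; proj₂)
open import Data.Sum using (_⊎_; inj₁; inj₂)
open import Data.Unit using (tt) renaming (⊤ to Unit)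
open import Data.Empty using (⊥-elim)
open import Data.Vec using ([]; _∷_)
open import Data.List using (List; []; _∷_)
open import Data.List.NonEmpty using (List⁺; _∷_)
open import Data.Bool using (if_then_else_)
open import Relation.Nullary using (Dec; yes; no; ¬_; does)
open import Relation.Nullary.Decidable using (_×-dec_; _⊎-dec_; ¬?)

-- Finite undirected multigraphs: vertices Fin n, edges Fin m, each edge
-- has an (arbitrarily ordered) pair of endpoints.  Parallel edges and
-- loops are allowed.

record Graph : Set where
  field
    n    : ℕ
    m    : ℕ
    ends : Fin m → Fin n × Fin n
open Graph public

Crosses : (G : Graph) → Subset (n G) → Fin (m G) → Set
Crosses G X e =
  (proj₁ (ends G e) ∈ X × proj₂ (ends G e) ∉ X) ⊎
  (proj₁ (ends G e) ∉ X × proj₂ (ends G e) ∈ X)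

-- The spanning subgraph (V, A) is connected (Bondy–Murty definition):
-- for every partition of V into two nonempty sets X and V∖X there is an
-- edge of A with one end in X and the other in V∖X.
ConnectedSub : (G : Graph) → Subset (m G) → Set
ConnectedSub G A =
  (X : Subset (n G)) → (∃ λ v → v ∈ X) → (∃ λ v → v ∉ X) →
  ∃ λ e → e ∈ A × Crosses G X e

Connected : Graph → Set
Connected G = ConnectedSub G ⊤

crosses? : (G : Graph) (X : Subset (n G)) (e : Fin (m G)) → Dec (Crosses G X e)
crosses? G X e =
  ((proj₁ (ends G e) ∈? X) ×-dec ¬? (proj₂ (ends G e) ∈? X)) ⊎-dec
  (¬? (proj₁ (ends G e) ∈? X) ×-dec (proj₂ (ends G e) ∈? X))

connectedSub? : (G : Graph) (A : Subset (m G)) → Dec (ConnectedSub G A)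
connectedSub? G A with anySubset? bad?
  where
  cross? : (X : Subset (n G)) → Dec (∃ λ e → e ∈ A × Crosses G X e)
  cross? X = any? λ e → (e ∈? A) ×-dec crosses? G X e
  bad? : (X : Subset (n G)) → Dec _
  bad? X = any? (λ v → v ∈? X) ×-dec (any? (λ v → ¬? (v ∈? X)) ×-dec ¬? (cross? X))
... | yes (X , a , b , nc) = no λ c → nc (c X a b)
... | no nb = yes λ X a b → helper X a b
  where
  helper : (X : Subset (n G)) → (∃ λ v → v ∈ X) → (∃ λ v → v ∉ X) →
           ∃ λ e → e ∈ A × Crosses G X e
  helper X a b with any? (λ e → (e ∈? A) ×-dec crosses? G X e)
  ... | yes c = c
  ... | no nc = ⊥-elim (nb (X , a , b , nc))

ℕtoℚ : ℕ → ℚ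
ℕtoℚ k = (+ k) / 1

infixr 8 _^_
_^_ : ℚ → ℕ → ℚ
q ^ zero  = 1ℚ
q ^ suc k = q * (q ^ k)

-- Total reciprocal (convention 1/0 := 0); it is only ever applied to
-- nonzero arguments under the hypotheses of the theorem.
inv : ℚ → ℚ
inv q with q ≟ 0ℚ
... | yes _  = 0ℚ
... | no q≢0 = 1/_ q {{ℚB.≢-nonZero q≢0}}

sumSubsets : (k : ℕ) → (Subset k → ℚ) → ℚ
sumSubsets zero    f = f []
sumSubsets (suc k) f = sumSubsets k (λ A → f (inside ∷ A)) + sumSubsets k (λ A → f (outside ∷ A))

ZR : Graph → ℚ → ℚ
ZR G w = sumSubsets (m G) λ A → if does (connectedSub? G A) then w ^ ∣ A ∣ else 0ℚ

-- Two-terminal graphs with distinct terminals: vertices Fin (2 + p),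
-- vertex 0 = left terminal, vertex 1 = right terminal, the p others internal.

record TwoTerminal : Set where
  field
    p     : ℕ
    q     : ℕ
    tends : Fin q → Fin (2 ℕ.+ p) × Fin (2 ℕ.+ p)
open TwoTerminal public

inner : (l' : ℕ) → Fin (suc l') → Fin l' ⊎ Unit
inner zero     zero    = inj₂ tt
inner (suc l') zero    = inj₁ zero
inner (suc l') (suc i) with inner l' i
... | inj₁ j = inj₁ (suc j)
... | inj₂ t = inj₂ t

-- (h, l)-bounce: h internally disjoint paths of length l between the terminals.
-- For l = suc l' each path has l' internal vertices; path j's position
-- t ∈ {0,…,l} is a vertex, edge t of path j joins positions t and t+1.
bounce : ℕ → ℕ → TwoTerminal
bounce h zero = record { p = 0 ; q = 0 ; tends = λ () }  -- never used (s_i > 1)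
bounce h (suc l') = record { p = h ℕ.* l' ; q = h ℕ.* suc l' ; tends = te }
  where
  pos : Fin h → Fin (2 ℕ.+ l') → Fin (2 ℕ.+ h ℕ.* l')
  pos j zero = zero
  pos j (suc i) with inner l' i
  ... | inj₁ k = suc (suc (combine j k))
  ... | inj₂ _ = suc zero
  te : Fin (h ℕ.* suc l') → Fin (2 ℕ.+ h ℕ.* l') × Fin (2 ℕ.+ h ℕ.* l')
  te x with remQuot (suc l') x
  ... | (j , t) = pos j (inject₁ t) , pos j (suc t)

-- Series composition (concatenation): right terminal of H₁ identified with
-- left terminal of H₂.  Internal vertices: 0 = the identified middle vertex,
-- then the internal vertices of H₁, then those of H₂.
series : TwoTerminal → TwoTerminal → TwoTerminal
series H₁ H₂ = record { p = suc (p H₁ ℕ.+ p H₂) ; q = q H₁ ℕ.+ q H₂ ; tends = te }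
  where
  V = Fin (2 ℕ.+ suc (p H₁ ℕ.+ p H₂))
  f₁ : Fin (2 ℕ.+ p H₁) → V
  f₁ zero = zero
  f₁ (suc zero) = suc (suc zero)
  f₁ (suc (suc i)) = suc (suc (suc (i ↑ˡ p H₂)))
  f₂ : Fin (2 ℕ.+ p H₂) → V
  f₂ zero = suc (suc zero)
  f₂ (suc zero) = suc zero
  f₂ (suc (suc i)) = suc (suc (suc (p H₁ ↑ʳ i)))
  te : Fin (q H₁ ℕ.+ q H₂) → V × V
  te x with splitAt (q H₁) x
  ... | inj₁ e = f₁ (proj₁ (tends H₁ e)) , f₁ (proj₂ (tends H₁ e))
  ... | inj₂ e = f₂ (proj₁ (tends H₂ e)) , f₂ (proj₂ (tends H₂ e))

-- Bounce graph B_S of a (nonempty) bounce sequence S = ⟨s₁,…,s_k⟩: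
-- concatenation of the (i, s_i)-bounces, i = 1,…,k.
bounceFrom : ℕ → ℕ → List ℕ → TwoTerminal
bounceFrom i s []        = bounce i s
bounceFrom i s (s' ∷ ss) = series (bounce i s) (bounceFrom (suc i) s' ss)

bounceGraph : List⁺ ℕ → TwoTerminal
bounceGraph (s ∷ ss) = bounceFrom 1 s ss

-- H-inflation G ⊗ H: every edge xy = ends e of G is replaced by a fresh
-- copy of H with left terminal ↦ x and right terminal ↦ y.
-- Vertices: the n vertices of G, then p internal vertices per edge of G.
_⊗_ : Graph → TwoTerminal → Graph
G ⊗ H = record { n = n G ℕ.+ m G ℕ.* p H ; m = m G ℕ.* q H ; ends = en }
  where
  emb : Fin (m G) → Fin (2 ℕ.+ p H) → Fin (n G ℕ.+ m G ℕ.* p H)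
  emb e zero = proj₁ (ends G e) ↑ˡ (m G ℕ.* p H)
  emb e (suc zero) = proj₂ (ends G e) ↑ˡ (m G ℕ.* p H)
  emb e (suc (suc j)) = n G ↑ʳ combine e j
  en : Fin (m G ℕ.* q H) → Fin (n G ℕ.+ m G ℕ.* p H) × Fin (n G ℕ.+ m G ℕ.* p H)
  en x with remQuot (q H) x
  ... | (e , f) = emb e (proj₁ (tends H f)) , emb e (proj₂ (tends H f))

sumIdx : (ℕ → ℕ → ℚ) → ℕ → List ℕ → ℚ
sumIdx t i []       = 0ℚ
sumIdx t i (s ∷ ss) = t i s + sumIdx t (suc i) ss

prodIdx : (ℕ → ℕ → ℚ) → ℕ → List ℕ → ℚ
prodIdx t i []       = 1ℚ
prodIdx t i (s ∷ ss) = t i s * prodIdx t (suc i) ss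

toList : List⁺ ℕ → List ℕ
toList (s ∷ ss) = s ∷ ss

invWS : List⁺ ℕ → ℚ → ℚ
invWS S w = sumIdx (λ i s → inv ((1ℚ + w * inv (ℕtoℚ s)) ^ i - 1ℚ)) 1 (toList S)

wS : List⁺ ℕ → ℚ → ℚ
wS S w = inv (invWS S w)

CS : List⁺ ℕ → ℚ → ℚ
CS S w = invWS S w *
  prodIdx (λ i s → (w ^ ((s ℕ.∸ 1) ℕ.* i)) * ((w + ℕtoℚ s) ^ i - ℕtoℚ s ^ i)) 1 (toList S)

module Submission where

-- An edge set of G ⊗ H is
-- connected iff on every copy of H it is rooted (each component meets a terminal)
-- and the copies on which it is connected form a connected spanning subgraph of G.
-- Summing w^|A| copy by copy gives Z_R(G ⊗ H; w) = N^m · Z_R(G; T/N), where T sums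
-- over the connected edge sets of H and N over those with two components, one per
-- terminal. Under series composition T is multiplicative and N obeys the product
-- rule N = T₁N₂ + N₁T₂; a path of length s has T = w^s and N = s w^(s−1); i
-- parallel copies of a two-terminal graph have T = (T + N)^i − N^i and N = N^i.
-- For H = B_S this yields N = C_S and T/N = w_S.

open import Defs
open import Function using (_∘_)
open import Data.Empty using (⊥-elim)
open import Data.Unit using (tt) renaming (⊤ to Unit)
open import Data.Bool using (Bool; true; false; not; _∧_; _∨_; _xor_; if_then_else_)
open import Data.Bool.Properties using (not-¬; ¬-not; not-involutive) renaming (_≟_ to _≟ᵇ_)
open import Data.Product using (Σ; _×_; _,_; ∃; proj₁; proj₂; swap)
open import Data.Sum using (_⊎_; inj₁; inj₂)
import Data.Sum as Sum
open import Data.Nat as ℕ using (ℕ; zero; suc; _<_)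
open import Data.Nat.Coprimality as Coprime using (Coprime; 1-coprimeTo)
open import Data.Integer as ℤ using (+_)
import Data.Integer.Properties as ℤ
open import Data.Rational using (ℚ; 0ℚ; 1ℚ; _+_; _*_; _-_; 1/_; mkℚ; positive) renaming (_<_ to _<ℚ_)
open import Data.Rational using () renaming (_*_ to _*ℚ_)
import Data.Rational.Base as ℚ using (≢-nonZero)
open import Data.Rational.Properties
  using ( *-comm; *-assoc; *-distribˡ-+; *-identityˡ; *-identityʳ; +-identityˡ; +-identityʳ
        ; *-zeroˡ; *-zeroʳ; *-inverseʳ; <⇒≢; positive⁻¹; pos*pos⇒pos; pos+pos⇒pos; 1/pos⇒pos
        ; normalize-coprime; toℚᵘ-injective; toℚᵘ-homo-+ )
  renaming (_≟_ to _≟ℚ_)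
import Data.Rational.Unnormalised.Base as ℚᵘ
import Data.Rational.Unnormalised.Properties as ℚᵘ
open import Data.Rational.Solver using (module +-*-Solver)
open +-*-Solver
open import Data.Fin using (Fin; zero; suc; inject₁; _≟_; _↑ˡ_; _↑ʳ_; splitAt; join; combine; remQuot; quotRem)
open import Data.Fin.Properties
  using (any?; all?; splitAt-↑ˡ; splitAt-↑ʳ; join-splitAt; remQuot-combine; combine-remQuot)
open import Data.Fin.Subset using (Subset; _∉_; inside; outside; ∣_∣)
open import Data.Fin.Subset.Properties using (anySubset?)
open import Data.Vec using ([]; _∷_; lookup; tabulate; _++_)
open import Data.Vec.Properties
  using ([]=⇒lookup; lookup⇒[]=; lookup∘tabulate; tabulate-cong; tabulate∘lookup; lookup-++ˡ; lookup-++ʳ)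
open import Data.List using ([]; _∷_)
import Data.List.Relation.Unary.All as List
open import Data.List.NonEmpty using (List⁺; _∷_)
open import Data.List.NonEmpty.Relation.Unary.All using (All; _∷_)
open import Relation.Nullary using (Dec; yes; no; ¬_; does)
open import Relation.Nullary.Decidable
  using (_×-dec_; _⊎-dec_; _→-dec_; ¬?; decidable-stable; dec-true; dec-false)
open import Relation.Binary.PropositionalEquality
open ≡-Reasoning

-- Connectivity through cuts

-- A colouring X : Subset (n G) stands for the vertex bipartition of Defs.ConnectedSub;
-- Adm selects the bipartitions that have to be crossed.
Hits : ∀ {k} → Subset k → Bool → Set
Hits X b = ∃ λ v → lookup X v ≡ b

Splits : (G : Graph) → Subset (n G) → Fin (m G) → Set
Splits G X e = lookup X (proj₁ (ends G e)) ≢ lookup X (proj₂ (ends G e))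

CutConnected : (G : Graph) → (Subset (n G) → Set) → (Fin (m G) → Set) → Set
CutConnected G Adm P = (X : Subset (n G)) → Adm X → Hits X true → Hits X false →
  ∃ λ e → P e × Splits G X e

NoCut : (G : Graph) → (Subset (n G) → Set) → (Fin (m G) → Set) → Subset (n G) → Set
NoCut G Adm P X = Adm X × Hits X true × Hits X false × (∀ e → P e → ¬ Splits G X e)

hits? : ∀ {k} (X : Subset k) b → Dec (Hits X b)
hits? X b = any? λ v → lookup X v ≟ᵇ b

splits? : (G : Graph) (X : Subset (n G)) (e : Fin (m G)) → Dec (Splits G X e)
splits? G X e = ¬? (lookup X (proj₁ (ends G e)) ≟ᵇ lookup X (proj₂ (ends G e)))

module _ (G : Graph) {Adm : Subset (n G) → Set} {P : Fin (m G) → Set}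
         (adm? : ∀ X → Dec (Adm X)) (P? : ∀ e → Dec (P e)) where

  noCut? : ∀ X → Dec (NoCut G Adm P X)
  noCut? X = adm? X ×-dec hits? X true ×-dec hits? X false ×-dec
             all? (λ e → P? e →-dec ¬? (splits? G X e))

  noCut⇒¬cutConnected : ∀ {X} → NoCut G Adm P X → ¬ CutConnected G Adm P
  noCut⇒¬cutConnected (a , t , f , unsplit) c with c _ a t f
  ... | (e , pe , s) = unsplit e pe s

  cutConnected-or-noCut : CutConnected G Adm P ⊎ ∃ (NoCut G Adm P)
  cutConnected-or-noCut with anySubset? noCut?
  ... | yes cut = inj₂ cut
  ... | no ¬cut = inj₁ split
    where
    split : CutConnected G Adm P
    split X a t f with any? (λ e → P? e ×-dec splits? G X e)
    ... | yes found = found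
    ... | no ¬found = ⊥-elim (¬cut (X , a , t , f , λ e pe s → ¬found (e , pe , s)))

  cutConnected? : Dec (CutConnected G Adm P)
  cutConnected? with cutConnected-or-noCut
  ... | inj₁ c = yes c
  ... | inj₂ (_ , cut) = no (noCut⇒¬cutConnected cut)

AnyColouring : ∀ {k} → Subset k → Set
AnyColouring _ = Unit

Selected : ∀ {k} → Subset k → Fin k → Set
Selected A e = lookup A e ≡ true

lookup-∉ : ∀ {k} {X : Subset k} {v} → v ∉ X → lookup X v ≡ false
lookup-∉ {X = X} {v} v∉X with lookup X v in eq
... | true = ⊥-elim (v∉X (lookup⇒[]= v X eq))
... | false = refl

∉-lookup : ∀ {k} {X : Subset k} {v} → lookup X v ≡ false → v ∉ X
∉-lookup eq v∈X with trans (sym ([]=⇒lookup v∈X)) eq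
... | ()

crosses⇒splits : (G : Graph) (X : Subset (n G)) (e : Fin (m G)) → Crosses G X e → Splits G X e
crosses⇒splits G X e (inj₁ (a , b)) eq with trans (sym ([]=⇒lookup a)) (trans eq (lookup-∉ b))
... | ()
crosses⇒splits G X e (inj₂ (a , b)) eq with trans (sym (lookup-∉ a)) (trans eq ([]=⇒lookup b))
... | ()

splits⇒crosses : (G : Graph) (X : Subset (n G)) (e : Fin (m G)) → Splits G X e → Crosses G X e
splits⇒crosses G X e s with lookup X (proj₁ (ends G e)) in e₁ | lookup X (proj₂ (ends G e)) in e₂
... | true  | true  = ⊥-elim (s refl)
... | false | false = ⊥-elim (s refl)
... | true  | false = inj₁ (lookup⇒[]= _ X e₁ , ∉-lookup e₂)
... | false | true  = inj₂ (∉-lookup e₁ , lookup⇒[]= _ X e₂)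

connectedSub⇒cutConnected : (G : Graph) (A : Subset (m G)) →
  ConnectedSub G A → CutConnected G AnyColouring (Selected A)
connectedSub⇒cutConnected G A c X _ (v , hv) (u , hu)
  with c X (v , lookup⇒[]= v X hv) (u , ∉-lookup hu)
... | (e , e∈A , cr) = e , []=⇒lookup e∈A , crosses⇒splits G X e cr

cutConnected⇒connectedSub : (G : Graph) (A : Subset (m G)) →
  CutConnected G AnyColouring (Selected A) → ConnectedSub G A
cutConnected⇒connectedSub G A c X (v , v∈X) (u , u∉X)
  with c X tt (v , []=⇒lookup v∈X) (u , lookup-∉ u∉X)
... | (e , sel , s) = e , lookup⇒[]= e A sel , splits⇒crosses G X e s

does-≡ : {P Q : Set} (p : Dec P) (q : Dec Q) → (P → Q) → (Q → P) → does p ≡ does q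
does-≡ (yes _) (yes _) _ _ = refl
does-≡ (no _)  (no _)  _ _ = refl
does-≡ (yes a) (no ¬b) f _ = ⊥-elim (¬b (f a))
does-≡ (no ¬a) (yes b) _ g = ⊥-elim (¬a (g b))

does-≡ᵇ : {P : Set} (d : Dec P) (b : Bool) → (P → b ≡ true) → (b ≡ true → P) → does d ≡ b
does-≡ᵇ (yes p) true  _ _ = refl
does-≡ᵇ (yes p) false f _ = sym (f p)
does-≡ᵇ (no ¬p) true  _ g = ⊥-elim (¬p (g refl))
does-≡ᵇ (no ¬p) false _ _ = refl

does⇒ : {P : Set} (d : Dec P) → does d ≡ true → P
does⇒ (yes p) _ = p

cutConnected-mono : ∀ (G : Graph) {Adm} {P Q : Fin (m G) → Set} → (∀ e → P e → Q e) →
                    CutConnected G Adm P → CutConnected G Adm Q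
cutConnected-mono G P⇒Q c X adm hitT hitF with c X adm hitT hitF
... | (e , pe , s) = e , P⇒Q e pe , s

sumSubsets-cong : ∀ k {f g : Subset k → ℚ} → (∀ A → f A ≡ g A) → sumSubsets k f ≡ sumSubsets k g
sumSubsets-cong zero    f≗g = f≗g []
sumSubsets-cong (suc k) f≗g = cong₂ _+_ (sumSubsets-cong k (f≗g ∘ (inside ∷_)))
                                        (sumSubsets-cong k (f≗g ∘ (outside ∷_)))

sumSubsets-0 : ∀ k → sumSubsets k (λ _ → 0ℚ) ≡ 0ℚ
sumSubsets-0 zero    = refl
sumSubsets-0 (suc k) = cong₂ _+_ (sumSubsets-0 k) (sumSubsets-0 k)

sumSubsets-+ : ∀ k (f g : Subset k → ℚ) →
  sumSubsets k (λ A → f A + g A) ≡ sumSubsets k f + sumSubsets k g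
sumSubsets-+ zero    f g = refl
sumSubsets-+ (suc k) f g = begin
  sumSubsets k (λ A → f (inside ∷ A) + g (inside ∷ A)) + sumSubsets k (λ A → f (outside ∷ A) + g (outside ∷ A))
    ≡⟨ cong₂ _+_ (sumSubsets-+ k _ _) (sumSubsets-+ k _ _) ⟩
  (fᵢ + gᵢ) + (fₒ + gₒ)
    ≡⟨ solve 4 (λ a b c d → (a :+ b) :+ (c :+ d) := (a :+ c) :+ (b :+ d)) refl fᵢ gᵢ fₒ gₒ ⟩
  (fᵢ + fₒ) + (gᵢ + gₒ) ∎
  where
  fᵢ = sumSubsets k (f ∘ (inside ∷_))
  gᵢ = sumSubsets k (g ∘ (inside ∷_))
  fₒ = sumSubsets k (f ∘ (outside ∷_))
  gₒ = sumSubsets k (g ∘ (outside ∷_))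

sumSubsets-*ˡ : ∀ k c (f : Subset k → ℚ) → sumSubsets k (λ A → c * f A) ≡ c * sumSubsets k f
sumSubsets-*ˡ zero    c f = refl
sumSubsets-*ˡ (suc k) c f =
  trans (cong₂ _+_ (sumSubsets-*ˡ k c _) (sumSubsets-*ˡ k c _)) (sym (*-distribˡ-+ c _ _))

sumSubsets-*ʳ : ∀ k c (f : Subset k → ℚ) → sumSubsets k (λ A → f A * c) ≡ sumSubsets k f * c
sumSubsets-*ʳ k c f = begin
  sumSubsets k (λ A → f A * c) ≡⟨ sumSubsets-cong k (λ A → *-comm (f A) c) ⟩
  sumSubsets k (λ A → c * f A) ≡⟨ sumSubsets-*ˡ k c f ⟩
  c * sumSubsets k f           ≡⟨ *-comm c _ ⟩
  sumSubsets k f * c           ∎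

sumSubsets-++ : ∀ k r (f : Subset (k ℕ.+ r) → ℚ) →
  sumSubsets (k ℕ.+ r) f ≡ sumSubsets k (λ B → sumSubsets r (λ C → f (B ++ C)))
sumSubsets-++ zero    r f = refl
sumSubsets-++ (suc k) r f = cong₂ _+_ (sumSubsets-++ k r _) (sumSubsets-++ k r _)

sumSubsets-product : ∀ k r (f : Subset k → ℚ) (g : Subset r → ℚ) →
  sumSubsets k (λ B → sumSubsets r (λ C → f B * g C)) ≡ sumSubsets k f * sumSubsets r g
sumSubsets-product k r f g =
  trans (sumSubsets-cong k (λ B → sumSubsets-*ˡ r (f B) g)) (sumSubsets-*ʳ k (sumSubsets r g) f)

^-+ : ∀ x a b → x ^ (a ℕ.+ b) ≡ x ^ a * x ^ b
^-+ x zero    b = sym (*-identityˡ _)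
^-+ x (suc a) b = trans (cong (x *_) (^-+ x a b)) (sym (*-assoc x _ _))

∣++∣ : ∀ {k r} (B : Subset k) (C : Subset r) → ∣ B ++ C ∣ ≡ ∣ B ∣ ℕ.+ ∣ C ∣
∣++∣ []          C = refl
∣++∣ (true ∷ B)  C = cong suc (∣++∣ B C)
∣++∣ (false ∷ B) C = ∣++∣ B C

^-∣++∣ : ∀ w {k r} (B : Subset k) (C : Subset r) → w ^ ∣ B ++ C ∣ ≡ w ^ ∣ B ∣ * w ^ ∣ C ∣
^-∣++∣ w B C = trans (cong (w ^_) (∣++∣ B C)) (^-+ w ∣ B ∣ ∣ C ∣)

^-distrib-* : ∀ x y k → (x * y) ^ k ≡ x ^ k * y ^ k
^-distrib-* x y zero    = sym (*-identityˡ 1ℚ)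
^-distrib-* x y (suc k) = trans (cong ((x * y) *_) (^-distrib-* x y k))
  (solve 4 (λ x y a b → (x :* y) :* (a :* b) := (x :* a) :* (y :* b)) refl x y (x ^ k) (y ^ k))

^-* : ∀ x a b → x ^ (a ℕ.* b) ≡ (x ^ a) ^ b
^-* x zero    b = sym (1^ b)
  where
  1^ : ∀ b → 1ℚ ^ b ≡ 1ℚ
  1^ zero    = refl
  1^ (suc b) = trans (cong (1ℚ *_) (1^ b)) (*-identityˡ 1ℚ)
^-* x (suc a) b = begin
  x ^ (b ℕ.+ a ℕ.* b)       ≡⟨ ^-+ x b (a ℕ.* b) ⟩
  x ^ b * x ^ (a ℕ.* b)     ≡⟨ cong (x ^ b *_) (^-* x a b) ⟩
  x ^ b * (x ^ a) ^ b       ≡⟨ ^-distrib-* x (x ^ a) b ⟨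
  (x * x ^ a) ^ b           ∎

coprime-1 : ∀ k → Coprime k 1
coprime-1 k = Coprime.sym (1-coprimeTo k)

ℕtoℚ-mkℚ : ∀ k → ℕtoℚ k ≡ mkℚ (+ k) 0 (coprime-1 k)
ℕtoℚ-mkℚ k = normalize-coprime (coprime-1 k)

ℕtoℚ-suc : ∀ k → ℕtoℚ (suc k) ≡ 1ℚ + ℕtoℚ k
ℕtoℚ-suc k rewrite ℕtoℚ-mkℚ k | ℕtoℚ-mkℚ (suc k) = toℚᵘ-injective
  (ℚᵘ.≃-trans (ℚᵘ.*≡* cross) (ℚᵘ.≃-sym (toℚᵘ-homo-+ 1ℚ (mkℚ (+ k) 0 (coprime-1 k)))))
  where
  cross : + suc k ℤ.* + 1 ≡ (+ 1 ℤ.* + 1 ℤ.+ + k ℤ.* + 1) ℤ.* + 1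
  cross = trans (ℤ.*-identityʳ _) (sym (trans (ℤ.*-identityʳ _) (cong (ℤ._+_ (+ 1)) (ℤ.*-identityʳ (+ k)))))

inv-nonZero : ∀ x (x≢0 : x ≢ 0ℚ) → inv x ≡ (1/ x) {{ℚ.≢-nonZero x≢0}}
inv-nonZero x x≢0 with x ≟ℚ 0ℚ
... | yes x≡0 = ⊥-elim (x≢0 x≡0)
... | no _    = refl

inv-inverseʳ : ∀ x → x ≢ 0ℚ → x * inv x ≡ 1ℚ
inv-inverseʳ x x≢0 rewrite inv-nonZero x x≢0 = *-inverseʳ x {{ℚ.≢-nonZero x≢0}}

inv-cancel : ∀ {c x y} → c ≢ 0ℚ → x * c ≡ y → x ≡ inv c * y
inv-cancel {c} {x} {y} c≢0 xc≡y = begin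
  x                   ≡⟨ *-identityʳ x ⟨
  x * 1ℚ              ≡⟨ cong (x *_) (inv-inverseʳ c c≢0) ⟨
  x * (c * inv c)     ≡⟨ solve 3 (λ x c i → x :* (c :* i) := i :* (x :* c)) refl x c (inv c) ⟩
  inv c * (x * c)     ≡⟨ cong (inv c *_) xc≡y ⟩
  inv c * y           ∎

pos-* : ∀ {x y} → 0ℚ <ℚ x → 0ℚ <ℚ y → 0ℚ <ℚ x * y
pos-* {x} {y} 0<x 0<y = positive⁻¹ (x * y) {{pos*pos⇒pos x {{positive 0<x}} y {{positive 0<y}}}}

pos-+ : ∀ {x y} → 0ℚ <ℚ x → 0ℚ <ℚ y → 0ℚ <ℚ x + y
pos-+ {x} {y} 0<x 0<y = positive⁻¹ (x + y) {{pos+pos⇒pos x {{positive 0<x}} y {{positive 0<y}}}}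

pos-inv : ∀ {x} → 0ℚ <ℚ x → 0ℚ <ℚ inv x
pos-inv {x} 0<x rewrite inv-nonZero x (≢-sym (<⇒≢ 0<x)) = positive⁻¹ _ {{1/pos⇒pos x {{positive 0<x}}}}

pos-ℕtoℚ : ∀ k → 0ℚ <ℚ ℕtoℚ (suc k)
pos-ℕtoℚ k rewrite ℕtoℚ-mkℚ (suc k) = positive⁻¹ _

geometricSum : ℚ → ℕ → ℚ
geometricSum y zero    = 1ℚ
geometricSum y (suc i) = 1ℚ + (1ℚ + y) * geometricSum y i

^-1-geometric : ∀ y i → (1ℚ + y) ^ suc i - 1ℚ ≡ y * geometricSum y i
^-1-geometric y zero    = solve 1 (λ y → (con 1ℚ :+ y) :* con 1ℚ :- con 1ℚ := y :* con 1ℚ) refl y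
^-1-geometric y (suc i) = begin
  (1ℚ + y) * (1ℚ + y) ^ suc i - 1ℚ
    ≡⟨ solve 2 (λ y P → (con 1ℚ :+ y) :* P :- con 1ℚ := (con 1ℚ :+ y) :* (P :- con 1ℚ) :+ y) refl
               y ((1ℚ + y) ^ suc i) ⟩
  (1ℚ + y) * ((1ℚ + y) ^ suc i - 1ℚ) + y
    ≡⟨ cong (λ z → (1ℚ + y) * z + y) (^-1-geometric y i) ⟩
  (1ℚ + y) * (y * geometricSum y i) + y
    ≡⟨ solve 2 (λ y g → (con 1ℚ :+ y) :* (y :* g) :+ y := y :* (con 1ℚ :+ (con 1ℚ :+ y) :* g)) refl
               y (geometricSum y i) ⟩
  y * geometricSum y (suc i) ∎

pos-geometricSum : ∀ {y} i → 0ℚ <ℚ y → 0ℚ <ℚ geometricSum y i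
pos-geometricSum zero    0<y = positive⁻¹ 1ℚ
pos-geometricSum (suc i) 0<y = pos-+ (positive⁻¹ 1ℚ) (pos-* (pos-+ (positive⁻¹ 1ℚ) 0<y) (pos-geometricSum i 0<y))

graphOf : TwoTerminal → Graph
graphOf H = record { n = 2 ℕ.+ p H ; m = q H ; ends = tends H }

TerminalsAgree : ∀ {k} → Subset (2 ℕ.+ k) → Set
TerminalsAgree X = lookup X zero ≡ lookup X (suc zero)

Connects : (H : TwoTerminal) → Subset (q H) → Set
Connects H B = CutConnected (graphOf H) AnyColouring (Selected B)

-- Every component of the spanning subgraph B contains a terminal.
Rooted : (H : TwoTerminal) → Subset (q H) → Set
Rooted H B = CutConnected (graphOf H) TerminalsAgree (Selected B)

connects⇒rooted : ∀ H B → Connects H B → Rooted H B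
connects⇒rooted H B c X _ = c X tt

opaque
  connects? : (H : TwoTerminal) (B : Subset (q H)) → Dec (Connects H B)
  connects? H B = cutConnected? (graphOf H) (λ _ → yes tt) (λ f → lookup B f ≟ᵇ true)

  rooted? : (H : TwoTerminal) (B : Subset (q H)) → Dec (Rooted H B)
  rooted? H B = cutConnected? (graphOf H) (λ X → lookup X zero ≟ᵇ lookup X (suc zero))
                              (λ f → lookup B f ≟ᵇ true)

connWeight : (H : TwoTerminal) → ℚ → Subset (q H) → ℚ
connWeight H w B = if does (connects? H B) then w ^ ∣ B ∣ else 0ℚ

splitWeight : (H : TwoTerminal) → ℚ → Subset (q H) → ℚ
splitWeight H w B = if does (rooted? H B) ∧ not (does (connects? H B)) then w ^ ∣ B ∣ else 0ℚ

-- Zsplit H w sums over the spanning subgraphs with exactly two components,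
-- one containing each terminal.
Zconn Zsplit : TwoTerminal → ℚ → ℚ
Zconn  H w = sumSubsets (q H) (connWeight H w)
Zsplit H w = sumSubsets (q H) (splitWeight H w)

connects⇒rootedᵇ : ∀ H B → does (connects? H B) ≡ true → does (rooted? H B) ≡ true
connects⇒rootedᵇ H B eq with connects? H B
... | yes c = dec-true (rooted? H B) (connects⇒rooted H B c)

-- Substitution

restrictBy : ∀ {a b} → (Fin a → Fin b) → Subset b → Subset a
restrictBy ι X = tabulate (lookup X ∘ ι)

-- Colourings of K are constrained by Adm ∘ restrict; in all instances below ι fixes
-- the terminals, so this is definitionally AnyColouring or TerminalsAgree on K.
record Substitution : Set₁ where
  field
    G K            : Graph
    H              : Fin (m G) → TwoTerminal
    ι              : Fin (n G) → Fin (n K)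
    emb            : (e : Fin (m G)) → Fin (2 ℕ.+ p (H e)) → Fin (n K)
    emb-left       : ∀ e → emb e zero ≡ ι (proj₁ (ends G e))
    emb-right      : ∀ e → emb e (suc zero) ≡ ι (proj₂ (ends G e))
    classify       : Fin (n K) → Fin (n G) ⊎ Σ (Fin (m G)) (Fin ∘ p ∘ H)
    classify-ι     : ∀ v → classify (ι v) ≡ inj₁ v
    classify-emb   : ∀ e j → classify (emb e (suc (suc j))) ≡ inj₂ (e , j)
    classify⁻¹-ι   : ∀ u v → classify u ≡ inj₁ v → u ≡ ι v
    classify⁻¹-emb : ∀ u e j → classify u ≡ inj₂ (e , j) → u ≡ emb e (suc (suc j))
    edge           : (e : Fin (m G)) → Fin (q (H e)) → Fin (m K)
    origin         : Fin (m K) → Σ (Fin (m G)) (Fin ∘ q ∘ H)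
    edge-origin    : ∀ x → edge (proj₁ (origin x)) (proj₂ (origin x)) ≡ x
    ends-edge      : ∀ e f → ends K (edge e f) ≡
                       (emb e (proj₁ (tends (H e) f)) , emb e (proj₂ (tends (H e) f)))
    Adm            : Subset (n G) → Set
    Adm-resp       : ∀ X Y → (∀ v → lookup X v ≡ lookup Y v) → Adm X → Adm Y
    Adm-const      : ∀ X b → (∀ v → lookup X v ≡ b) → Adm X

hits-both : ∀ {k} (Y : Subset k) a b → lookup Y a ≢ lookup Y b → Hits Y true × Hits Y false
hits-both Y a b ne with lookup Y a in ya | lookup Y b in yb
... | true  | true  = ⊥-elim (ne refl)
... | false | false = ⊥-elim (ne refl)
... | true  | false = (a , ya) , (b , yb)
... | false | true  = (b , yb) , (a , ya)

module _ (σ : Substitution) where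
  open Substitution σ

  restrict : Subset (n K) → Subset (n G)
  restrict = restrictBy ι

  block : Subset (m K) → (e : Fin (m G)) → Subset (q (H e))
  block A e = tabulate (lookup A ∘ edge e)

  onPiece : Subset (n K) → (e : Fin (m G)) → Subset (2 ℕ.+ p (H e))
  onPiece X e = tabulate (lookup X ∘ emb e)

  ConnectingPieces : Subset (m K) → Fin (m G) → Set
  ConnectingPieces A e = Connects (H e) (block A e)

  private
    onPiece-left : ∀ X e → lookup (onPiece X e) zero ≡ lookup (restrict X) (proj₁ (ends G e))
    onPiece-left X e = trans (cong (lookup X) (emb-left e)) (sym (lookup∘tabulate (lookup X ∘ ι) _))

    onPiece-right : ∀ X e → lookup (onPiece X e) (suc zero) ≡ lookup (restrict X) (proj₂ (ends G e))
    onPiece-right X e = trans (cong (lookup X) (emb-right e)) (sym (lookup∘tabulate (lookup X ∘ ι) _))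

    splits-edge⇔ : ∀ X e f →
      (Splits K X (edge e f) → Splits (graphOf (H e)) (onPiece X e) f) ×
      (Splits (graphOf (H e)) (onPiece X e) f → Splits K X (edge e f))
    splits-edge⇔ X e f rewrite ends-edge e f
                              | lookup∘tabulate (lookup X ∘ emb e) (proj₁ (tends (H e) f))
                              | lookup∘tabulate (lookup X ∘ emb e) (proj₂ (tends (H e) f))
      = (λ s → s) , (λ s → s)

    selected-edge : ∀ A e f → Selected (block A e) f → Selected A (edge e f)
    selected-edge A e f = trans (sym (lookup∘tabulate _ f))

    piece-split⇒split : ∀ A X e → (∃ λ f → Selected (block A e) f × Splits (graphOf (H e)) (onPiece X e) f) →
                        ∃ λ x → Selected A x × Splits K X x
    piece-split⇒split A X e (f , sel , s) = edge e f , selected-edge A e f sel , proj₂ (splits-edge⇔ X e f) s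

    -- If restrict X is constant, a vertex of the other colour lies inside
    -- some piece, whose restriction of X is then split by a selected edge.
    split-inside-piece : ∀ A → (∀ e → Rooted (H e) (block A e)) → ∀ X c →
      (∀ v → lookup (restrict X) v ≡ c) → Hits X (not c) → ∃ λ x → Selected A x × Splits K X x
    split-inside-piece A rooted X c const (u , Xu) with classify u in cu
    ... | inj₁ v = ⊥-elim (not-¬ (const v) (begin
        lookup (restrict X) v ≡⟨ lookup∘tabulate (lookup X ∘ ι) v ⟩
        lookup X (ι v)        ≡⟨ cong (lookup X) (sym (classify⁻¹-ι u v cu)) ⟩
        lookup X u            ≡⟨ Xu ⟩
        not c                 ∎))
    ... | inj₂ (e , j) = piece-split⇒split A X e
      (rooted e (onPiece X e) (trans Y₀ (sym Y₁)) (proj₁ hits) (proj₂ hits))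
      where
      Y₀ : lookup (onPiece X e) zero ≡ c
      Y₀ = trans (onPiece-left X e) (const _)
      Y₁ : lookup (onPiece X e) (suc zero) ≡ c
      Y₁ = trans (onPiece-right X e) (const _)
      Yⱼ : lookup (onPiece X e) (suc (suc j)) ≡ not c
      Yⱼ = trans (lookup∘tabulate (lookup X ∘ emb e) _) (trans (cong (lookup X) (sym (classify⁻¹-emb u e j cu))) Xu)
      hits = hits-both (onPiece X e) zero (suc (suc j)) (λ eq → not-¬ Y₀ (trans eq Yⱼ))

  cutConnected-substitution : ∀ A → (∀ e → Rooted (H e) (block A e)) →
    CutConnected G Adm (ConnectingPieces A) → CutConnected K (Adm ∘ restrict) (Selected A)
  cutConnected-substitution A rooted base X adm hitT hitF
    with hits? (restrict X) true | hits? (restrict X) false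
  ... | yes t | yes f = across (base (restrict X) adm t f)
    where
    across : (∃ λ e → ConnectingPieces A e × Splits G (restrict X) e) → ∃ λ x → Selected A x × Splits K X x
    across (e , connects , s) with hits-both (onPiece X e) zero (suc zero)
      (λ eq → s (trans (sym (onPiece-left X e)) (trans eq (onPiece-right X e))))
    ... | (t′ , f′) = piece-split⇒split A X e (connects (onPiece X e) tt t′ f′)
  ... | no ¬t | _ = split-inside-piece A rooted X false (λ v → ¬-not (λ eq → ¬t (v , eq))) hitT
  ... | yes _ | no ¬f = split-inside-piece A rooted X true (λ v → ¬-not (λ eq → ¬f (v , eq))) hitF

  private
    extend : (e : Fin (m G)) → Subset (2 ℕ.+ p (H e)) → Fin (n K) → Bool
    extend e Y u with classify u
    ... | inj₁ _ = lookup Y zero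
    ... | inj₂ (e′ , j) with e′ ≟ e
    ...   | yes refl = lookup Y (suc (suc j))
    ...   | no _     = lookup Y zero

    extend-ι : ∀ e Y v → extend e Y (ι v) ≡ lookup Y zero
    extend-ι e Y v rewrite classify-ι v = refl

    extend-same : ∀ e Y → TerminalsAgree Y → ∀ t → extend e Y (emb e t) ≡ lookup Y t
    extend-same e Y agree zero rewrite emb-left e = extend-ι e Y _
    extend-same e Y agree (suc zero) rewrite emb-right e = trans (extend-ι e Y _) agree
    extend-same e Y agree (suc (suc j)) rewrite classify-emb e j with e ≟ e
    ... | yes refl = refl
    ... | no e≢e = ⊥-elim (e≢e refl)

    extend-other : ∀ e Y e′ → e′ ≢ e → ∀ t → extend e Y (emb e′ t) ≡ lookup Y zero
    extend-other e Y e′ e′≢e zero rewrite emb-left e′ = extend-ι e Y _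
    extend-other e Y e′ e′≢e (suc zero) rewrite emb-right e′ = extend-ι e Y _
    extend-other e Y e′ e′≢e (suc (suc j)) rewrite classify-emb e′ j with e′ ≟ e
    ... | yes e′≡e = ⊥-elim (e′≢e e′≡e)
    ... | no _ = refl

  cutConnected⇒rooted : ∀ A → CutConnected K (Adm ∘ restrict) (Selected A) → ∀ e → Rooted (H e) (block A e)
  cutConnected⇒rooted A c e Y agree (a , Ya) (b , Yb) = back (c X adm hitT hitF)
    where
    X = tabulate (extend e Y)
    X-emb : ∀ e′ t → lookup X (emb e′ t) ≡ lookup (onPiece X e′) t
    X-emb e′ t = sym (lookup∘tabulate (lookup X ∘ emb e′) t)
    X-same : ∀ t → lookup (onPiece X e) t ≡ lookup Y t
    X-same t = trans (sym (X-emb e t)) (trans (lookup∘tabulate (extend e Y) _) (extend-same e Y agree t))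
    adm = Adm-const (restrict X) (lookup Y zero)
            (λ v → trans (lookup∘tabulate (lookup X ∘ ι) v) (trans (lookup∘tabulate (extend e Y) _) (extend-ι e Y v)))
    X-other : ∀ e′ → e′ ≢ e → ∀ t → lookup (onPiece X e′) t ≡ lookup Y zero
    X-other e′ e′≢e t = trans (sym (X-emb e′ t)) (trans (lookup∘tabulate (extend e Y) _) (extend-other e Y e′ e′≢e t))
    hitT = emb e a , trans (X-emb e a) (trans (X-same a) Ya)
    hitF = emb e b , trans (X-emb e b) (trans (X-same b) Yb)
    back : (∃ λ x → Selected A x × Splits K X x) → ∃ λ f → Selected (block A e) f × Splits (graphOf (H e)) Y f
    back (x , sel , s) with origin x | edge-origin x
    ... | (e′ , f) | refl with e′ ≟ e
    ...   | yes refl = f , trans (lookup∘tabulate _ f) sel ,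
                       λ eq → proj₁ (splits-edge⇔ X e f) s
                                (trans (X-same (proj₁ (tends (H e) f))) (trans eq (sym (X-same (proj₂ (tends (H e) f))))))
    ...   | no e′≢e = ⊥-elim (proj₁ (splits-edge⇔ X e′ f) s
                        (trans (X-other e′ e′≢e (proj₁ (tends (H e′) f))) (sym (X-other e′ e′≢e (proj₂ (tends (H e′) f))))))

  private
    PieceColouring : Subset (m K) → Subset (n G) → Fin (m G) → Set
    PieceColouring A X e = ∃ λ (Z : Fin (2 ℕ.+ p (H e)) → Bool) →
      Z zero ≡ lookup X (proj₁ (ends G e)) × Z (suc zero) ≡ lookup X (proj₂ (ends G e)) ×
      (∀ f → Selected (block A e) f → Z (proj₁ (tends (H e) f)) ≡ Z (proj₂ (tends (H e) f)))

    -- A piece that does not connect has an unsplit colouring Y hitting both colours;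
    -- as the piece is rooted, Y separates its terminals, so Y can be recoloured to match X there.
    pieceColouring : ∀ A → (∀ e → Rooted (H e) (block A e)) → ∀ X e →
      ¬ (ConnectingPieces A e × Splits G X e) → PieceColouring A X e
    pieceColouring A rooted X e ¬cs with lookup X (proj₁ (ends G e)) ≟ᵇ lookup X (proj₂ (ends G e))
    ... | yes eq = (λ _ → lookup X (proj₁ (ends G e))) , refl , eq , λ _ _ → refl
    ... | no ne with cutConnected-or-noCut (graphOf (H e)) (λ _ → yes tt) (λ f → lookup (block A e) f ≟ᵇ true)
    ...   | inj₁ connects = ⊥-elim (¬cs (connects , ne))
    ...   | inj₂ (Y , _ , hitT , hitF , unsplit) =
      (λ t → lookup Y t xor (lookup Y zero xor x)) ,
      xor-cancelˡ (lookup Y zero) x ,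
      xor-flip Y₀≢Y₁ ne ,
      λ f sel → cong (_xor (lookup Y zero xor x)) (decidable-stable (_ ≟ᵇ _) (unsplit f sel))
      where
      x = lookup X (proj₁ (ends G e))
      Y₀≢Y₁ : lookup Y zero ≢ lookup Y (suc zero)
      Y₀≢Y₁ agree with rooted e Y agree hitT hitF
      ... | (f , sel , s) = unsplit f sel s
      xor-cancelˡ : ∀ a b → a xor (a xor b) ≡ b
      xor-cancelˡ true  b = not-involutive b
      xor-cancelˡ false b = refl
      xor-flip : ∀ {a b c d} → a ≢ b → c ≢ d → b xor (a xor c) ≡ d
      xor-flip {true}  {true}  a≢b _ = ⊥-elim (a≢b refl)
      xor-flip {false} {false} a≢b _ = ⊥-elim (a≢b refl)
      xor-flip {true}  {false} _ c≢d = sym (¬-not (c≢d ∘ sym))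
      xor-flip {false} {true}  _ c≢d = sym (¬-not (c≢d ∘ sym))

  cutConnected⇒base : ∀ A → CutConnected K (Adm ∘ restrict) (Selected A) → CutConnected G Adm (ConnectingPieces A)
  cutConnected⇒base A c X adm (v , Xv) (u , Xu)
    with any? (λ e → connects? (H e) (block A e) ×-dec splits? G X e)
  ... | yes found = found
  ... | no ¬found = ⊥-elim (unsplit (c X′ adm′ (ι v , trans (X′-ι v) Xv) (ι u , trans (X′-ι u) Xu)))
    where
    Z : ∀ e → PieceColouring A X e
    Z e = pieceColouring A (cutConnected⇒rooted A c) X e (λ cs → ¬found (e , cs))
    colour : Fin (n K) → Bool
    colour y with classify y
    ... | inj₁ v′ = lookup X v′
    ... | inj₂ (e , j) = proj₁ (Z e) (suc (suc j))
    X′ = tabulate colour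
    X′-ι : ∀ v′ → lookup X′ (ι v′) ≡ lookup X v′
    X′-ι v′ rewrite lookup∘tabulate colour (ι v′) | classify-ι v′ = refl
    X′-emb : ∀ e t → lookup (onPiece X′ e) t ≡ proj₁ (Z e) t
    X′-emb e zero = trans (onPiece-left X′ e) (trans (lookup∘tabulate (lookup X′ ∘ ι) _)
                      (trans (X′-ι _) (sym (proj₁ (proj₂ (Z e))))))
    X′-emb e (suc zero) = trans (onPiece-right X′ e) (trans (lookup∘tabulate (lookup X′ ∘ ι) _)
                      (trans (X′-ι _) (sym (proj₁ (proj₂ (proj₂ (Z e)))))))
    X′-emb e (suc (suc j)) rewrite lookup∘tabulate (lookup X′ ∘ emb e) (suc (suc j))
                                 | lookup∘tabulate colour (emb e (suc (suc j)))
                                 | classify-emb e j = refl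
    adm′ = Adm-resp X (restrict X′) (λ v′ → sym (trans (lookup∘tabulate (lookup X′ ∘ ι) v′) (X′-ι v′))) adm
    unsplit : ¬ ∃ λ x → Selected A x × Splits K X′ x
    unsplit (x , sel , s) with origin x | edge-origin x
    ... | (e , f) | refl = proj₁ (splits-edge⇔ X′ e f) s (begin
      lookup (onPiece X′ e) (proj₁ (tends (H e) f)) ≡⟨ X′-emb e _ ⟩
      proj₁ (Z e) (proj₁ (tends (H e) f))           ≡⟨ proj₂ (proj₂ (proj₂ (Z e))) f (trans (lookup∘tabulate _ f) sel) ⟩
      proj₁ (Z e) (proj₂ (tends (H e) f))           ≡⟨ X′-emb e _ ⟨
      lookup (onPiece X′ e) (proj₂ (tends (H e) f)) ∎)

anyColouring-resp : ∀ {k} (X Y : Subset k) → (∀ v → lookup X v ≡ lookup Y v) → AnyColouring X → AnyColouring Y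
anyColouring-resp _ _ _ _ = tt

anyColouring-const : ∀ {k} (X : Subset k) b → (∀ v → lookup X v ≡ b) → AnyColouring X
anyColouring-const _ _ _ = tt

terminalsAgree-resp : ∀ {k} (X Y : Subset (2 ℕ.+ k)) → (∀ v → lookup X v ≡ lookup Y v) →
                      TerminalsAgree X → TerminalsAgree Y
terminalsAgree-resp X Y X≗Y agree = trans (sym (X≗Y zero)) (trans agree (X≗Y (suc zero)))

terminalsAgree-const : ∀ {k} (X : Subset (2 ℕ.+ k)) b → (∀ v → lookup X v ≡ b) → TerminalsAgree X
terminalsAgree-const X b const = trans (const zero) (sym (const (suc zero)))

embedUniform : (G : Graph) (H : TwoTerminal) → Fin (m G) → Fin (2 ℕ.+ p H) → Fin (n G ℕ.+ m G ℕ.* p H)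
embedUniform G H e zero          = proj₁ (ends G e) ↑ˡ (m G ℕ.* p H)
embedUniform G H e (suc zero)    = proj₂ (ends G e) ↑ˡ (m G ℕ.* p H)
embedUniform G H e (suc (suc j)) = n G ↑ʳ combine e j

uniformSubstitution : (G : Graph) (H : TwoTerminal)
  (ends′ : Fin (m G ℕ.* q H) → Fin (n G ℕ.+ m G ℕ.* p H) × Fin (n G ℕ.+ m G ℕ.* p H)) →
  (∀ e f → ends′ (combine e f) ≡ (embedUniform G H e (proj₁ (tends H f)) , embedUniform G H e (proj₂ (tends H f)))) →
  (Adm : Subset (n G) → Set) →
  (∀ X Y → (∀ v → lookup X v ≡ lookup Y v) → Adm X → Adm Y) →
  (∀ X b → (∀ v → lookup X v ≡ b) → Adm X) → Substitution
uniformSubstitution G H ends′ ends′-combine Adm resp const = record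
  { G = G
  ; K = record { n = n G ℕ.+ m G ℕ.* p H ; m = m G ℕ.* q H ; ends = ends′ }
  ; H = λ _ → H
  ; ι = _↑ˡ (m G ℕ.* p H)
  ; emb = embedUniform G H
  ; emb-left = λ _ → refl
  ; emb-right = λ _ → refl
  ; classify = classify
  ; classify-ι = λ v → cong (Sum.map₂ (remQuot (p H))) (splitAt-↑ˡ (n G) v _)
  ; classify-emb = λ e j → trans (cong (Sum.map₂ (remQuot (p H))) (splitAt-↑ʳ (n G) _ (combine e j)))
                                 (cong inj₂ (remQuot-combine e j))
  ; classify⁻¹-ι = classify⁻¹-ι
  ; classify⁻¹-emb = classify⁻¹-emb
  ; edge = combine
  ; origin = remQuot (q H)
  ; edge-origin = combine-remQuot {m G} (q H)
  ; ends-edge = ends′-combine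
  ; Adm = Adm
  ; Adm-resp = resp
  ; Adm-const = const
  }
  where
  classify : Fin (n G ℕ.+ m G ℕ.* p H) → Fin (n G) ⊎ Σ (Fin (m G)) (λ _ → Fin (p H))
  classify u = Sum.map₂ (remQuot (p H)) (splitAt (n G) u)
  classify⁻¹-ι : ∀ u v → classify u ≡ inj₁ v → u ≡ v ↑ˡ (m G ℕ.* p H)
  classify⁻¹-ι u v eq with splitAt (n G) u in split
  ... | inj₁ _ with refl ← eq = trans (sym (join-splitAt (n G) _ u)) (cong (join (n G) _) split)
  classify⁻¹-emb : ∀ u e j → classify u ≡ inj₂ (e , j) → u ≡ n G ↑ʳ combine e j
  classify⁻¹-emb u e j eq with splitAt (n G) u in split
  ... | inj₂ r with refl ← eq = trans (sym (join-splitAt (n G) _ u))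
    (trans (cong (join (n G) _) split) (cong (n G ↑ʳ_) (sym (combine-remQuot {m G} (p H) r))))

quotRem-combine : ∀ {a k} (e : Fin a) (f : Fin k) → quotRem k (combine e f) ≡ (f , e)
quotRem-combine e f = cong swap (remQuot-combine e f)

ends-⊗ : (G : Graph) (H : TwoTerminal) → ∀ e f →
  ends (G ⊗ H) (combine e f) ≡ (embedUniform G H e (proj₁ (tends H f)) , embedUniform G H e (proj₂ (tends H f)))
ends-⊗ G H e f rewrite quotRem-combine {m G} {q H} e f with proj₁ (tends H f) | proj₂ (tends H f)
... | zero        | zero        = refl
... | zero        | suc zero    = refl
... | zero        | suc (suc _) = refl
... | suc zero    | zero        = refl
... | suc zero    | suc zero    = refl
... | suc zero    | suc (suc _) = refl
... | suc (suc _) | zero        = refl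
... | suc (suc _) | suc zero    = refl
... | suc (suc _) | suc (suc _) = refl

-- Block sums

allᵇ : ∀ k → (Fin k → Bool) → Bool
allᵇ zero    _ = true
allᵇ (suc k) f = f zero ∧ allᵇ k (f ∘ suc)

allᵇ-cong : ∀ k {f g : Fin k → Bool} → (∀ i → f i ≡ g i) → allᵇ k f ≡ allᵇ k g
allᵇ-cong zero    f≗g = refl
allᵇ-cong (suc k) f≗g = cong₂ _∧_ (f≗g zero) (allᵇ-cong k (f≗g ∘ suc))

∧-true⁻ : ∀ a {b} → a ∧ b ≡ true → a ≡ true × b ≡ true
∧-true⁻ true eq = refl , eq

allᵇ-true : ∀ k {f : Fin k → Bool} → (∀ i → f i ≡ true) → allᵇ k f ≡ true
allᵇ-true zero    _   = refl
allᵇ-true (suc k) all = cong₂ _∧_ (all zero) (allᵇ-true k (all ∘ suc))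

allᵇ-true⁻ : ∀ k {f : Fin k → Bool} → allᵇ k f ≡ true → ∀ i → f i ≡ true
allᵇ-true⁻ (suc k) {f} eq zero    = proj₁ (∧-true⁻ (f zero) eq)
allᵇ-true⁻ (suc k) {f} eq (suc i) = allᵇ-true⁻ k (proj₂ (∧-true⁻ (f zero) eq)) i

if-∧-indicator : ∀ a b (x : ℚ) → (if a ∧ b then x else 0ℚ) ≡ (if a then (if b then 1ℚ else 0ℚ) else 0ℚ) * x
if-∧-indicator true  true  x = sym (*-identityˡ x)
if-∧-indicator true  false x = sym (*-zeroˡ x)
if-∧-indicator false b     x = sym (*-zeroˡ x)

module BlockSum (H : TwoTerminal) (w : ℚ) where

  blockOf : ∀ {k} → Subset (k ℕ.* q H) → Fin k → Subset (q H)
  blockOf A e = tabulate (lookup A ∘ combine e)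

  connectingBlocks : ∀ {k} → Subset (k ℕ.* q H) → Subset k
  connectingBlocks A = tabulate (λ e → does (connects? H (blockOf A e)))

  allRooted : ∀ k → Subset (k ℕ.* q H) → Bool
  allRooted k A = allᵇ k (λ e → does (rooted? H (blockOf A e)))

  weight : ∀ {k} → Subset k → ℚ
  weight []          = 1ℚ
  weight (true ∷ c)  = Zconn H w * weight c
  weight (false ∷ c) = Zsplit H w * weight c

  private
    blockOf-zero : ∀ {k} B (C : Subset (k ℕ.* q H)) → blockOf {suc k} (B ++ C) zero ≡ B
    blockOf-zero B C = trans (tabulate-cong (lookup-++ˡ B C)) (tabulate∘lookup B)

    blockOf-suc : ∀ {k} B (C : Subset (k ℕ.* q H)) e → blockOf {suc k} (B ++ C) (suc e) ≡ blockOf C e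
    blockOf-suc B C e = tabulate-cong (λ f → lookup-++ʳ B C (combine e f))

    allRooted-++ : ∀ k B C → allRooted (suc k) (B ++ C) ≡ does (rooted? H B) ∧ allRooted k C
    allRooted-++ k B C = cong₂ _∧_ (cong (does ∘ rooted? H) (blockOf-zero {k} B C))
                                   (allᵇ-cong k (cong (does ∘ rooted? H) ∘ blockOf-suc {k} B C))

    connectingBlocks-++ : ∀ k B C → connectingBlocks {suc k} (B ++ C) ≡ does (connects? H B) ∷ connectingBlocks {k} C
    connectingBlocks-++ k B C = cong₂ _∷_ (cong (does ∘ connects? H) (blockOf-zero {k} B C))
                                          (tabulate-cong (cong (does ∘ connects? H) ∘ blockOf-suc {k} B C))

  blockSum : ∀ k → (Subset k → ℚ) → ℚ
  blockSum k g = sumSubsets (k ℕ.* q H) λ A →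
    (if allRooted k A then g (connectingBlocks A) else 0ℚ) * w ^ ∣ A ∣

  private
    blockSum-first : ∀ k (g : Subset (suc k) → ℚ) B →
      sumSubsets (k ℕ.* q H) (λ C → (if allRooted (suc k) (B ++ C) then g (connectingBlocks (B ++ C)) else 0ℚ) * w ^ ∣ B ++ C ∣)
      ≡ (if does (rooted? H B) then w ^ ∣ B ∣ * blockSum k (λ c → g (does (connects? H B) ∷ c)) else 0ℚ)
    blockSum-first k g B = trans (sumSubsets-cong (k ℕ.* q H) split) (factor (does (rooted? H B)))
      where
      g′ = λ C → g (does (connects? H B) ∷ connectingBlocks C)
      split : ∀ C → (if allRooted (suc k) (B ++ C) then g (connectingBlocks (B ++ C)) else 0ℚ) * w ^ ∣ B ++ C ∣ ≡
                    (if does (rooted? H B) ∧ allRooted k C then g′ C else 0ℚ) * (w ^ ∣ B ∣ * w ^ ∣ C ∣)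
      split C rewrite allRooted-++ k B C | connectingBlocks-++ k B C =
        cong ((if does (rooted? H B) ∧ allRooted k C then g′ C else 0ℚ) *_) (^-∣++∣ w B C)
      factor : ∀ b → sumSubsets (k ℕ.* q H) (λ C → (if b ∧ allRooted k C then g′ C else 0ℚ) * (w ^ ∣ B ∣ * w ^ ∣ C ∣))
                     ≡ (if b then w ^ ∣ B ∣ * blockSum k (λ c → g (does (connects? H B) ∷ c)) else 0ℚ)
      factor true = trans (sumSubsets-cong (k ℕ.* q H) (λ C → solve 3 (λ a x y → a :* (x :* y) := x :* (a :* y)) refl
                                                                 (if allRooted k C then g′ C else 0ℚ) (w ^ ∣ B ∣) (w ^ ∣ C ∣)))
                          (sumSubsets-*ˡ (k ℕ.* q H) (w ^ ∣ B ∣) _)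
      factor false = trans (sumSubsets-cong (k ℕ.* q H) (λ C → *-zeroˡ (w ^ ∣ B ∣ * w ^ ∣ C ∣))) (sumSubsets-0 (k ℕ.* q H))

    split-by-connects : ∀ (r c : Bool) → (c ≡ true → r ≡ true) → ∀ (x y₁ y₀ : ℚ) →
      (if r then x * (if c then y₁ else y₀) else 0ℚ) ≡
      (if c then x else 0ℚ) * y₁ + (if r ∧ not c then x else 0ℚ) * y₀
    split-by-connects true  true  _ x y₁ y₀ = solve 3 (λ x y₁ y₀ → x :* y₁ := x :* y₁ :+ con 0ℚ :* y₀) refl x y₁ y₀
    split-by-connects true  false _ x y₁ y₀ = solve 3 (λ x y₁ y₀ → x :* y₀ := con 0ℚ :* y₁ :+ x :* y₀) refl x y₁ y₀
    split-by-connects false true  c⇒r _ _ _ with () ← c⇒r refl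
    split-by-connects false false _ x y₁ y₀ = solve 2 (λ y₁ y₀ → con 0ℚ := con 0ℚ :* y₁ :+ con 0ℚ :* y₀) refl y₁ y₀

  blockSum-weight : ∀ k g → blockSum k g ≡ sumSubsets k (λ c → g c * weight c)
  blockSum-weight zero    g = refl
  blockSum-weight (suc k) g = begin
    blockSum (suc k) g
      ≡⟨ sumSubsets-++ (q H) (k ℕ.* q H) _ ⟩
    sumSubsets (q H) (λ B → sumSubsets (k ℕ.* q H) _)
      ≡⟨ sumSubsets-cong (q H) (λ B → trans (blockSum-first k g B) (by-induction B)) ⟩
    sumSubsets (q H) (λ B → if does (rooted? H B) then w ^ ∣ B ∣ * (if does (connects? H B) then S₁ else S₀) else 0ℚ)
      ≡⟨ sumSubsets-cong (q H) (λ B → split-by-connects _ _ (connects⇒rootedᵇ H B) (w ^ ∣ B ∣) S₁ S₀) ⟩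
    sumSubsets (q H) (λ B → connWeight H w B * S₁ + splitWeight H w B * S₀)
      ≡⟨ sumSubsets-+ (q H) _ _ ⟩
    sumSubsets (q H) (λ B → connWeight H w B * S₁) + sumSubsets (q H) (λ B → splitWeight H w B * S₀)
      ≡⟨ cong₂ _+_ (sumSubsets-*ʳ (q H) S₁ _) (sumSubsets-*ʳ (q H) S₀ _) ⟩
    Zconn H w * S₁ + Zsplit H w * S₀
      ≡⟨ cong₂ _+_ (sym (sumSubsets-*ˡ k (Zconn H w) _)) (sym (sumSubsets-*ˡ k (Zsplit H w) _)) ⟩
    sumSubsets k (λ c → Zconn H w * (g (true ∷ c) * weight c)) + sumSubsets k (λ c → Zsplit H w * (g (false ∷ c) * weight c))
      ≡⟨ cong₂ _+_ (sumSubsets-cong k (λ c → reassoc (Zconn H w) (g (true ∷ c)) (weight c)))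
                   (sumSubsets-cong k (λ c → reassoc (Zsplit H w) (g (false ∷ c)) (weight c))) ⟩
    sumSubsets (suc k) (λ c → g c * weight c) ∎
    where
    S₁ = sumSubsets k (λ c → g (true ∷ c) * weight c)
    S₀ = sumSubsets k (λ c → g (false ∷ c) * weight c)
    by-induction : ∀ B → (if does (rooted? H B) then w ^ ∣ B ∣ * blockSum k (λ c → g (does (connects? H B) ∷ c)) else 0ℚ)
                       ≡ (if does (rooted? H B) then w ^ ∣ B ∣ * (if does (connects? H B) then S₁ else S₀) else 0ℚ)
    by-induction B with does (connects? H B)
    ... | true  = cong (λ s → if does (rooted? H B) then w ^ ∣ B ∣ * s else 0ℚ) (blockSum-weight k (g ∘ (true ∷_)))
    ... | false = cong (λ s → if does (rooted? H B) then w ^ ∣ B ∣ * s else 0ℚ) (blockSum-weight k (g ∘ (false ∷_)))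
    reassoc : ∀ t a b → t * (a * b) ≡ a * (t * b)
    reassoc = solve 3 (λ t a b → t :* (a :* b) := a :* (t :* b)) refl

-- Series composition and paths

-- Vertices 0 and 1 are the terminals, 2 is the middle vertex.
seriesSkeleton : Graph
seriesSkeleton = record { n = 3 ; m = 2 ; ends = ends′ }
  where
  ends′ : Fin 2 → Fin 3 × Fin 3
  ends′ zero       = zero , suc (suc zero)
  ends′ (suc zero) = suc (suc zero) , suc zero

parallelSkeleton : ℕ → Graph
parallelSkeleton h = record { n = 2 ; m = h ; ends = λ _ → zero , suc zero }

private
  constant₃ : ∀ b → ¬ Hits {3} (b ∷ b ∷ b ∷ []) (not b)
  constant₃ true  (zero , ())
  constant₃ true  (suc zero , ())
  constant₃ true  (suc (suc zero) , ())
  constant₃ false (zero , ())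
  constant₃ false (suc zero , ())
  constant₃ false (suc (suc zero) , ())

  constant₂ : ∀ b → ¬ Hits {2} (b ∷ b ∷ []) (not b)
  constant₂ true  (zero , ())
  constant₂ true  (suc zero , ())
  constant₂ false (zero , ())
  constant₂ false (suc zero , ())

  t≢f : true ≢ false
  t≢f ()

  f≢t : false ≢ true
  f≢t ()

module _ {Q : Fin 2 → Set} where

  seriesSkeleton-any⇒ : CutConnected seriesSkeleton AnyColouring Q → Q zero × Q (suc zero)
  seriesSkeleton-any⇒ c = first (c (true ∷ false ∷ false ∷ []) tt (zero , refl) (suc zero , refl)) ,
                          second (c (false ∷ true ∷ false ∷ []) tt (suc zero , refl) (zero , refl))
    where
    first : (∃ λ e → Q e × Splits seriesSkeleton (true ∷ false ∷ false ∷ []) e) → Q zero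
    first (zero , q , _) = q
    first (suc zero , _ , s) = ⊥-elim (s refl)
    second : (∃ λ e → Q e × Splits seriesSkeleton (false ∷ true ∷ false ∷ []) e) → Q (suc zero)
    second (zero , _ , s) = ⊥-elim (s refl)
    second (suc zero , q , _) = q

  seriesSkeleton-any⇐ : Q zero → Q (suc zero) → CutConnected seriesSkeleton AnyColouring Q
  seriesSkeleton-any⇐ q₀ q₁ (true ∷ true ∷ true ∷ [])    _ _ h = ⊥-elim (constant₃ true h)
  seriesSkeleton-any⇐ q₀ q₁ (false ∷ false ∷ false ∷ []) _ h _ = ⊥-elim (constant₃ false h)
  seriesSkeleton-any⇐ q₀ q₁ (true ∷ _ ∷ false ∷ [])      _ _ _ = zero , q₀ , t≢f
  seriesSkeleton-any⇐ q₀ q₁ (false ∷ _ ∷ true ∷ [])      _ _ _ = zero , q₀ , f≢t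
  seriesSkeleton-any⇐ q₀ q₁ (true ∷ false ∷ true ∷ [])   _ _ _ = suc zero , q₁ , t≢f
  seriesSkeleton-any⇐ q₀ q₁ (false ∷ true ∷ false ∷ [])  _ _ _ = suc zero , q₁ , f≢t

  seriesSkeleton-agree⇒ : CutConnected seriesSkeleton TerminalsAgree Q → Q zero ⊎ Q (suc zero)
  seriesSkeleton-agree⇒ c with c (false ∷ false ∷ true ∷ []) refl (suc (suc zero) , refl) (zero , refl)
  ... | (zero , q , _) = inj₁ q
  ... | (suc zero , q , _) = inj₂ q

  seriesSkeleton-agree⇐ : Q zero ⊎ Q (suc zero) → CutConnected seriesSkeleton TerminalsAgree Q
  seriesSkeleton-agree⇐ _         (true ∷ true ∷ true ∷ [])    _ _ h = ⊥-elim (constant₃ true h)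
  seriesSkeleton-agree⇐ _         (false ∷ false ∷ false ∷ []) _ h _ = ⊥-elim (constant₃ false h)
  seriesSkeleton-agree⇐ (inj₁ q₀) (true ∷ true ∷ false ∷ [])   _ _ _ = zero , q₀ , t≢f
  seriesSkeleton-agree⇐ (inj₁ q₀) (false ∷ false ∷ true ∷ [])  _ _ _ = zero , q₀ , f≢t
  seriesSkeleton-agree⇐ (inj₂ q₁) (true ∷ true ∷ false ∷ [])   _ _ _ = suc zero , q₁ , f≢t
  seriesSkeleton-agree⇐ (inj₂ q₁) (false ∷ false ∷ true ∷ [])  _ _ _ = suc zero , q₁ , t≢f
  seriesSkeleton-agree⇐ _         (true ∷ false ∷ _ ∷ [])      () _ _
  seriesSkeleton-agree⇐ _         (false ∷ true ∷ _ ∷ [])      () _ _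

module _ {h : ℕ} {Q : Fin h → Set} where

  parallelSkeleton-any⇒ : CutConnected (parallelSkeleton h) AnyColouring Q → ∃ Q
  parallelSkeleton-any⇒ c with c (true ∷ false ∷ []) tt (zero , refl) (suc zero , refl)
  ... | (e , q , _) = e , q

  parallelSkeleton-any⇐ : ∃ Q → CutConnected (parallelSkeleton h) AnyColouring Q
  parallelSkeleton-any⇐ _       (true ∷ true ∷ [])   _ _ hit = ⊥-elim (constant₂ true hit)
  parallelSkeleton-any⇐ _       (false ∷ false ∷ []) _ hit _ = ⊥-elim (constant₂ false hit)
  parallelSkeleton-any⇐ (e , q) (true ∷ false ∷ [])  _ _ _   = e , q , t≢f
  parallelSkeleton-any⇐ (e , q) (false ∷ true ∷ [])  _ _ _   = e , q , f≢t

  parallelSkeleton-agree : CutConnected (parallelSkeleton h) TerminalsAgree Q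
  parallelSkeleton-agree (true ∷ true ∷ [])   _ _ hit = ⊥-elim (constant₂ true hit)
  parallelSkeleton-agree (false ∷ false ∷ []) _ hit _ = ⊥-elim (constant₂ false hit)
  parallelSkeleton-agree (true ∷ false ∷ [])  () _ _
  parallelSkeleton-agree (false ∷ true ∷ [])  () _ _

module Series (H₁ H₂ : TwoTerminal) where

  piece : Fin 2 → TwoTerminal
  piece zero       = H₁
  piece (suc zero) = H₂

  private
    V = Fin (2 ℕ.+ suc (p H₁ ℕ.+ p H₂))

    emb : (e : Fin 2) → Fin (2 ℕ.+ p (piece e)) → V
    emb zero       zero          = zero
    emb zero       (suc zero)    = suc (suc zero)
    emb zero       (suc (suc i)) = suc (suc (suc (i ↑ˡ p H₂)))
    emb (suc zero) zero          = suc (suc zero)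
    emb (suc zero) (suc zero)    = suc zero
    emb (suc zero) (suc (suc i)) = suc (suc (suc (p H₁ ↑ʳ i)))

    edge : (e : Fin 2) → Fin (q (piece e)) → Fin (q H₁ ℕ.+ q H₂)
    edge zero       f = f ↑ˡ q H₂
    edge (suc zero) f = q H₁ ↑ʳ f

    origin : Fin (q H₁ ℕ.+ q H₂) → Σ (Fin 2) (Fin ∘ q ∘ piece)
    origin x with splitAt (q H₁) x
    ... | inj₁ f = zero , f
    ... | inj₂ f = suc zero , f

    edge-origin : ∀ x → edge (proj₁ (origin x)) (proj₂ (origin x)) ≡ x
    edge-origin x with splitAt (q H₁) x in split
    ... | inj₁ f = trans (cong (join (q H₁) (q H₂)) (sym split)) (join-splitAt (q H₁) (q H₂) x)
    ... | inj₂ f = trans (cong (join (q H₁) (q H₂)) (sym split)) (join-splitAt (q H₁) (q H₂) x)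

    ends-edge : ∀ e f → tends (series H₁ H₂) (edge e f) ≡
                  (emb e (proj₁ (tends (piece e) f)) , emb e (proj₂ (tends (piece e) f)))
    ends-edge zero f rewrite splitAt-↑ˡ (q H₁) f (q H₂) with proj₁ (tends H₁ f) | proj₂ (tends H₁ f)
    ... | zero        | zero        = refl
    ... | zero        | suc zero    = refl
    ... | zero        | suc (suc _) = refl
    ... | suc zero    | zero        = refl
    ... | suc zero    | suc zero    = refl
    ... | suc zero    | suc (suc _) = refl
    ... | suc (suc _) | zero        = refl
    ... | suc (suc _) | suc zero    = refl
    ... | suc (suc _) | suc (suc _) = refl
    ends-edge (suc zero) f rewrite splitAt-↑ʳ (q H₁) (q H₂) f with proj₁ (tends H₂ f) | proj₂ (tends H₂ f)
    ... | zero        | zero        = refl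
    ... | zero        | suc zero    = refl
    ... | zero        | suc (suc _) = refl
    ... | suc zero    | zero        = refl
    ... | suc zero    | suc zero    = refl
    ... | suc zero    | suc (suc _) = refl
    ... | suc (suc _) | zero        = refl
    ... | suc (suc _) | suc zero    = refl
    ... | suc (suc _) | suc (suc _) = refl

    classifyInternal : Fin (p H₁) ⊎ Fin (p H₂) → Fin 3 ⊎ Σ (Fin 2) (Fin ∘ p ∘ piece)
    classifyInternal (inj₁ i) = inj₂ (zero , i)
    classifyInternal (inj₂ i) = inj₂ (suc zero , i)

    classify : V → Fin 3 ⊎ Σ (Fin 2) (Fin ∘ p ∘ piece)
    classify zero                = inj₁ zero
    classify (suc zero)          = inj₁ (suc zero)
    classify (suc (suc zero))    = inj₁ (suc (suc zero))
    classify (suc (suc (suc r))) = classifyInternal (splitAt (p H₁) r)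

    ι : Fin 3 → V
    ι v = v ↑ˡ (p H₁ ℕ.+ p H₂)

    classify-ι : ∀ v → classify (ι v) ≡ inj₁ v
    classify-ι zero             = refl
    classify-ι (suc zero)       = refl
    classify-ι (suc (suc zero)) = refl

    classify-emb : ∀ e j → classify (emb e (suc (suc j))) ≡ inj₂ (e , j)
    classify-emb zero       j rewrite splitAt-↑ˡ (p H₁) j (p H₂) = refl
    classify-emb (suc zero) j rewrite splitAt-↑ʳ (p H₁) (p H₂) j = refl

    classify⁻¹-ι : ∀ u v → classify u ≡ inj₁ v → u ≡ ι v
    classify⁻¹-ι zero             _ refl = refl
    classify⁻¹-ι (suc zero)       _ refl = refl
    classify⁻¹-ι (suc (suc zero)) _ refl = refl
    classify⁻¹-ι (suc (suc (suc r))) v eq with splitAt (p H₁) r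
    ... | inj₁ _ with () ← eq
    ... | inj₂ _ with () ← eq

    classify⁻¹-emb : ∀ u e j → classify u ≡ inj₂ (e , j) → u ≡ emb e (suc (suc j))
    classify⁻¹-emb (suc (suc (suc r))) e j eq with splitAt (p H₁) r in split
    ... | inj₁ i with refl ← eq = cong (λ r′ → suc (suc (suc r′)))
                    (trans (sym (join-splitAt (p H₁) (p H₂) r)) (cong (join (p H₁) (p H₂)) split))
    ... | inj₂ i with refl ← eq = cong (λ r′ → suc (suc (suc r′)))
                    (trans (sym (join-splitAt (p H₁) (p H₂) r)) (cong (join (p H₁) (p H₂)) split))

  substitution : (Adm : Subset 3 → Set) →
    (∀ X Y → (∀ v → lookup X v ≡ lookup Y v) → Adm X → Adm Y) →
    (∀ X b → (∀ v → lookup X v ≡ b) → Adm X) → Substitution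
  substitution Adm resp const = record
    { G = seriesSkeleton ; K = graphOf (series H₁ H₂) ; H = piece ; ι = ι ; emb = emb
    ; emb-left = λ { zero → refl ; (suc zero) → refl }
    ; emb-right = λ { zero → refl ; (suc zero) → refl }
    ; classify = classify ; classify-ι = classify-ι ; classify-emb = classify-emb
    ; classify⁻¹-ι = classify⁻¹-ι ; classify⁻¹-emb = classify⁻¹-emb
    ; edge = edge ; origin = origin ; edge-origin = edge-origin ; ends-edge = ends-edge
    ; Adm = Adm ; Adm-resp = resp ; Adm-const = const }

  private
    anyCol = substitution AnyColouring anyColouring-resp anyColouring-const
    agreeCol = substitution TerminalsAgree terminalsAgree-resp terminalsAgree-const

    block-zero : ∀ B C → block anyCol (B ++ C) zero ≡ B
    block-zero B C = trans (tabulate-cong (lookup-++ˡ B C)) (tabulate∘lookup B)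

    block-one : ∀ B C → block anyCol (B ++ C) (suc zero) ≡ C
    block-one B C = trans (tabulate-cong (lookup-++ʳ B C)) (tabulate∘lookup C)

    connects⇔ : ∀ B C → (Connects (series H₁ H₂) (B ++ C) → Connects H₁ B × Connects H₂ C) ×
                        (Connects H₁ B × Connects H₂ C → Connects (series H₁ H₂) (B ++ C))
    connects⇔ B C = to , from
      where
      to : Connects (series H₁ H₂) (B ++ C) → Connects H₁ B × Connects H₂ C
      to c with seriesSkeleton-any⇒ (cutConnected⇒base anyCol (B ++ C) c)
      ... | (c₁ , c₂) = subst (Connects H₁) (block-zero B C) c₁ , subst (Connects H₂) (block-one B C) c₂
      from : Connects H₁ B × Connects H₂ C → Connects (series H₁ H₂) (B ++ C)
      from (c₁ , c₂) = cutConnected-substitution anyCol (B ++ C) rooted (seriesSkeleton-any⇐ c₁′ c₂′)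
        where
        c₁′ = subst (Connects H₁) (sym (block-zero B C)) c₁
        c₂′ = subst (Connects H₂) (sym (block-one B C)) c₂
        rooted : ∀ e → Rooted (piece e) (block anyCol (B ++ C) e)
        rooted zero       = connects⇒rooted H₁ (block anyCol (B ++ C) zero) c₁′
        rooted (suc zero) = connects⇒rooted H₂ (block anyCol (B ++ C) (suc zero)) c₂′

    rooted⇔ : ∀ B C →
      (Rooted (series H₁ H₂) (B ++ C) → Rooted H₁ B × Rooted H₂ C × (Connects H₁ B ⊎ Connects H₂ C)) ×
      (Rooted H₁ B × Rooted H₂ C × (Connects H₁ B ⊎ Connects H₂ C) → Rooted (series H₁ H₂) (B ++ C))
    rooted⇔ B C = to , from
      where
      to : Rooted (series H₁ H₂) (B ++ C) → Rooted H₁ B × Rooted H₂ C × (Connects H₁ B ⊎ Connects H₂ C)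
      to c = subst (Rooted H₁) (block-zero B C) (cutConnected⇒rooted agreeCol (B ++ C) c zero) ,
             subst (Rooted H₂) (block-one B C) (cutConnected⇒rooted agreeCol (B ++ C) c (suc zero)) ,
             Sum.map (subst (Connects H₁) (block-zero B C)) (subst (Connects H₂) (block-one B C))
                     (seriesSkeleton-agree⇒ (cutConnected⇒base agreeCol (B ++ C) c))
      from : Rooted H₁ B × Rooted H₂ C × (Connects H₁ B ⊎ Connects H₂ C) → Rooted (series H₁ H₂) (B ++ C)
      from (r₁ , r₂ , c) = cutConnected-substitution agreeCol (B ++ C) rooted
        (seriesSkeleton-agree⇐ (Sum.map (subst (Connects H₁) (sym (block-zero B C)))
                                        (subst (Connects H₂) (sym (block-one B C))) c))
        where
        rooted : ∀ e → Rooted (piece e) (block agreeCol (B ++ C) e)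
        rooted zero       = subst (Rooted H₁) (sym (block-zero B C)) r₁
        rooted (suc zero) = subst (Rooted H₂) (sym (block-one B C)) r₂

  connects?-++ : ∀ B C → does (connects? (series H₁ H₂) (B ++ C)) ≡ does (connects? H₁ B) ∧ does (connects? H₂ C)
  connects?-++ B C = does-≡ (connects? (series H₁ H₂) (B ++ C)) (connects? H₁ B ×-dec connects? H₂ C)
                            (proj₁ (connects⇔ B C)) (proj₂ (connects⇔ B C))

  rooted?-++ : ∀ B C → does (rooted? (series H₁ H₂) (B ++ C)) ≡
    does (rooted? H₁ B) ∧ (does (rooted? H₂ C) ∧ (does (connects? H₁ B) ∨ does (connects? H₂ C)))
  rooted?-++ B C = does-≡ (rooted? (series H₁ H₂) (B ++ C))
                          (rooted? H₁ B ×-dec rooted? H₂ C ×-dec (connects? H₁ B ⊎-dec connects? H₂ C))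
                          (proj₁ (rooted⇔ B C)) (proj₂ (rooted⇔ B C))

  private
    if-∧-* : ∀ a b (x y : ℚ) → (if a ∧ b then x * y else 0ℚ) ≡ (if a then x else 0ℚ) * (if b then y else 0ℚ)
    if-∧-* true  true  x y = refl
    if-∧-* true  false x y = sym (*-zeroʳ x)
    if-∧-* false true  x y = sym (*-zeroˡ y)
    if-∧-* false false x y = sym (*-zeroˡ 0ℚ)

    split-series : ∀ r₁ c₁ r₂ c₂ → (c₁ ≡ true → r₁ ≡ true) → (c₂ ≡ true → r₂ ≡ true) → ∀ (x y : ℚ) →
      (if (r₁ ∧ (r₂ ∧ (c₁ ∨ c₂))) ∧ not (c₁ ∧ c₂) then x * y else 0ℚ) ≡
      (if c₁ then x else 0ℚ) * (if r₂ ∧ not c₂ then y else 0ℚ) + (if r₁ ∧ not c₁ then x else 0ℚ) * (if c₂ then y else 0ℚ)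
    split-series false true  _     _     c⇒r _   _ _ with () ← c⇒r refl
    split-series _     _     false true  _   c⇒r _ _ with () ← c⇒r refl
    split-series true  true  true  true  _ _ x y = solve 2 (λ x y → con 0ℚ := x :* con 0ℚ :+ con 0ℚ :* y) refl x y
    split-series true  true  true  false _ _ x y = solve 2 (λ x y → x :* y := x :* y :+ con 0ℚ :* con 0ℚ) refl x y
    split-series true  true  false false _ _ x y = solve 2 (λ x y → con 0ℚ := x :* con 0ℚ :+ con 0ℚ :* con 0ℚ) refl x y
    split-series true  false true  true  _ _ x y = solve 2 (λ x y → x :* y := con 0ℚ :* con 0ℚ :+ x :* y) refl x y
    split-series true  false true  false _ _ x y = solve 2 (λ x y → con 0ℚ := con 0ℚ :* y :+ x :* con 0ℚ) refl x y
    split-series true  false false false _ _ x y = solve 2 (λ x y → con 0ℚ := con 0ℚ :* con 0ℚ :+ x :* con 0ℚ) refl x y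
    split-series false false true  true  _ _ x y = solve 2 (λ x y → con 0ℚ := con 0ℚ :* con 0ℚ :+ con 0ℚ :* y) refl x y
    split-series false false true  false _ _ x y = solve 2 (λ x y → con 0ℚ := con 0ℚ :* y :+ con 0ℚ :* con 0ℚ) refl x y
    split-series false false false false _ _ x y = solve 2 (λ x y → con 0ℚ := con 0ℚ :* con 0ℚ :+ con 0ℚ :* con 0ℚ) refl x y

  Zconn-series : ∀ w → Zconn (series H₁ H₂) w ≡ Zconn H₁ w * Zconn H₂ w
  Zconn-series w = begin
    Zconn (series H₁ H₂) w
      ≡⟨ sumSubsets-++ (q H₁) (q H₂) _ ⟩
    sumSubsets (q H₁) (λ B → sumSubsets (q H₂) (λ C → connWeight (series H₁ H₂) w (B ++ C)))
      ≡⟨ sumSubsets-cong (q H₁) (λ B → sumSubsets-cong (q H₂) (factor B)) ⟩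
    sumSubsets (q H₁) (λ B → sumSubsets (q H₂) (λ C → connWeight H₁ w B * connWeight H₂ w C))
      ≡⟨ sumSubsets-product (q H₁) (q H₂) _ _ ⟩
    Zconn H₁ w * Zconn H₂ w ∎
    where
    factor : ∀ B C → connWeight (series H₁ H₂) w (B ++ C) ≡ connWeight H₁ w B * connWeight H₂ w C
    factor B C rewrite connects?-++ B C | ^-∣++∣ w B C =
      if-∧-* (does (connects? H₁ B)) (does (connects? H₂ C)) (w ^ ∣ B ∣) (w ^ ∣ C ∣)

  Zsplit-series : ∀ w → Zsplit (series H₁ H₂) w ≡ Zconn H₁ w * Zsplit H₂ w + Zsplit H₁ w * Zconn H₂ w
  Zsplit-series w = begin
    Zsplit (series H₁ H₂) w
      ≡⟨ sumSubsets-++ (q H₁) (q H₂) _ ⟩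
    sumSubsets (q H₁) (λ B → sumSubsets (q H₂) (λ C → splitWeight (series H₁ H₂) w (B ++ C)))
      ≡⟨ sumSubsets-cong (q H₁) (λ B → sumSubsets-cong (q H₂) (expand B)) ⟩
    sumSubsets (q H₁) (λ B → sumSubsets (q H₂) (λ C →
      connWeight H₁ w B * splitWeight H₂ w C + splitWeight H₁ w B * connWeight H₂ w C))
      ≡⟨ sumSubsets-cong (q H₁) (λ B → sumSubsets-+ (q H₂) _ _) ⟩
    sumSubsets (q H₁) (λ B → sumSubsets (q H₂) (λ C → connWeight H₁ w B * splitWeight H₂ w C) +
                             sumSubsets (q H₂) (λ C → splitWeight H₁ w B * connWeight H₂ w C))
      ≡⟨ sumSubsets-+ (q H₁) (λ B → sumSubsets (q H₂) (λ C → connWeight H₁ w B * splitWeight H₂ w C))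
                             (λ B → sumSubsets (q H₂) (λ C → splitWeight H₁ w B * connWeight H₂ w C)) ⟩
    sumSubsets (q H₁) (λ B → sumSubsets (q H₂) (λ C → connWeight H₁ w B * splitWeight H₂ w C)) +
    sumSubsets (q H₁) (λ B → sumSubsets (q H₂) (λ C → splitWeight H₁ w B * connWeight H₂ w C))
      ≡⟨ cong₂ _+_ (sumSubsets-product (q H₁) (q H₂) _ _) (sumSubsets-product (q H₁) (q H₂) _ _) ⟩
    Zconn H₁ w * Zsplit H₂ w + Zsplit H₁ w * Zconn H₂ w ∎
    where
    expand : ∀ B C → splitWeight (series H₁ H₂) w (B ++ C) ≡
                     connWeight H₁ w B * splitWeight H₂ w C + splitWeight H₁ w B * connWeight H₂ w C
    expand B C rewrite rooted?-++ B C | connects?-++ B C | ^-∣++∣ w B C =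
      split-series (does (rooted? H₁ B)) (does (connects? H₁ B)) (does (rooted? H₂ C)) (does (connects? H₂ C))
                   (connects⇒rootedᵇ H₁ B) (connects⇒rootedᵇ H₂ C) (w ^ ∣ B ∣) (w ^ ∣ C ∣)

-- Position t of a path with l′ internal vertices: t = 0 and t = l′ + 1 are the
-- terminals, 0 < t ≤ l′ is internal vertex t − 1 (the numbering of bounce).
pathPos : (l′ : ℕ) → Fin (2 ℕ.+ l′) → Fin (2 ℕ.+ l′)
pathPos l′ zero = zero
pathPos l′ (suc i) with inner l′ i
... | inj₁ k = suc (suc k)
... | inj₂ _ = suc zero

path : ℕ → TwoTerminal
path l′ = record { p = l′ ; q = suc l′ ; tends = λ t → pathPos l′ (inject₁ t) , pathPos l′ (suc t) }

singleEdge : TwoTerminal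
singleEdge = path 0

tends-path-suc : ∀ l′ x → tends (series singleEdge (path l′)) x ≡ tends (path (suc l′)) x
tends-path-suc l′ zero = refl
tends-path-suc l′ (suc zero) with inner l′ zero
... | inj₁ _ = refl
... | inj₂ _ = refl
tends-path-suc l′ (suc (suc y)) with inner l′ (inject₁ y) | inner l′ (suc y)
... | inj₁ _ | inj₁ _ = refl
... | inj₁ _ | inj₂ _ = refl
... | inj₂ _ | inj₁ _ = refl
... | inj₂ _ | inj₂ _ = refl

module _ {a b : ℕ} (t₁ t₂ : Fin b → Fin (2 ℕ.+ a) × Fin (2 ℕ.+ a)) (t₁≗t₂ : ∀ x → t₁ x ≡ t₂ x) where
  private
    H₁ H₂ : TwoTerminal
    H₁ = record { p = a ; q = b ; tends = t₁ }
    H₂ = record { p = a ; q = b ; tends = t₂ }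

    cutConnected-cong : ∀ {t t′ : Fin b → Fin (2 ℕ.+ a) × Fin (2 ℕ.+ a)} → (∀ x → t x ≡ t′ x) → ∀ {Adm P} →
      CutConnected (graphOf (record { p = a ; q = b ; tends = t })) Adm P →
      CutConnected (graphOf (record { p = a ; q = b ; tends = t′ })) Adm P
    cutConnected-cong t≗t′ c X adm hitT hitF with c X adm hitT hitF
    ... | (e , pe , s) = e , pe , λ eq → s (subst (λ r → lookup X (proj₁ r) ≡ lookup X (proj₂ r)) (sym (t≗t′ e)) eq)

    connects-cong : ∀ B → does (connects? H₁ B) ≡ does (connects? H₂ B)
    connects-cong B = does-≡ (connects? H₁ B) (connects? H₂ B)
                             (cutConnected-cong t₁≗t₂) (cutConnected-cong (sym ∘ t₁≗t₂))

    rooted-cong : ∀ B → does (rooted? H₁ B) ≡ does (rooted? H₂ B)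
    rooted-cong B = does-≡ (rooted? H₁ B) (rooted? H₂ B)
                           (cutConnected-cong t₁≗t₂) (cutConnected-cong (sym ∘ t₁≗t₂))

  Zconn-cong : ∀ w → Zconn H₁ w ≡ Zconn H₂ w
  Zconn-cong w = sumSubsets-cong b (λ B → cong (λ c → if c then w ^ ∣ B ∣ else 0ℚ) (connects-cong B))

  Zsplit-cong : ∀ w → Zsplit H₁ w ≡ Zsplit H₂ w
  Zsplit-cong w = sumSubsets-cong b (λ B →
    cong₂ (λ r c → if r ∧ not c then w ^ ∣ B ∣ else 0ℚ) (rooted-cong B) (connects-cong B))

private
  singleEdge-connects : Connects singleEdge (true ∷ [])
  singleEdge-connects (true ∷ true ∷ [])   _ _ hit = ⊥-elim (constant₂ true hit)
  singleEdge-connects (false ∷ false ∷ []) _ hit _ = ⊥-elim (constant₂ false hit)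
  singleEdge-connects (true ∷ false ∷ [])  _ _ _   = zero , refl , t≢f
  singleEdge-connects (false ∷ true ∷ [])  _ _ _   = zero , refl , f≢t

  singleEdge-¬connects : ¬ Connects singleEdge (false ∷ [])
  singleEdge-¬connects c with c (true ∷ false ∷ []) tt (zero , refl) (suc zero , refl)
  ... | (zero , () , _)

  singleEdge-rooted : Rooted singleEdge (false ∷ [])
  singleEdge-rooted (true ∷ true ∷ [])   _ _ hit = ⊥-elim (constant₂ true hit)
  singleEdge-rooted (false ∷ false ∷ []) _ hit _ = ⊥-elim (constant₂ false hit)
  singleEdge-rooted (true ∷ false ∷ [])  () _ _
  singleEdge-rooted (false ∷ true ∷ [])  () _ _

Zconn-singleEdge : ∀ w → Zconn singleEdge w ≡ w
Zconn-singleEdge w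
  rewrite dec-true (connects? singleEdge (true ∷ [])) singleEdge-connects
        | dec-false (connects? singleEdge (false ∷ [])) singleEdge-¬connects
  = trans (+-identityʳ (w * 1ℚ)) (*-identityʳ w)

Zsplit-singleEdge : ∀ w → Zsplit singleEdge w ≡ 1ℚ
Zsplit-singleEdge w
  rewrite dec-true (connects? singleEdge (true ∷ [])) singleEdge-connects
        | dec-false (connects? singleEdge (false ∷ [])) singleEdge-¬connects
        | dec-true (rooted? singleEdge (true ∷ [])) (connects⇒rooted singleEdge (true ∷ []) singleEdge-connects)
        | dec-true (rooted? singleEdge (false ∷ [])) singleEdge-rooted
  = +-identityˡ 1ℚ

Zconn-path : ∀ l′ w → Zconn (path l′) w ≡ w ^ suc l′
Zconn-path zero     w = trans (Zconn-singleEdge w) (sym (*-identityʳ w))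
Zconn-path (suc l′) w = begin
  Zconn (path (suc l′)) w                       ≡⟨ Zconn-cong _ _ (tends-path-suc l′) w ⟨
  Zconn (series singleEdge (path l′)) w         ≡⟨ Series.Zconn-series singleEdge (path l′) w ⟩
  Zconn singleEdge w * Zconn (path l′) w         ≡⟨ cong₂ _*_ (Zconn-singleEdge w) (Zconn-path l′ w) ⟩
  w ^ suc (suc l′)                              ∎

Zsplit-path : ∀ l′ w → Zsplit (path l′) w ≡ ℕtoℚ (suc l′) * w ^ l′
Zsplit-path zero     w = Zsplit-singleEdge w
Zsplit-path (suc l′) w = begin
  Zsplit (path (suc l′)) w                                          ≡⟨ Zsplit-cong _ _ (tends-path-suc l′) w ⟨
  Zsplit (series singleEdge (path l′)) w                            ≡⟨ Series.Zsplit-series singleEdge (path l′) w ⟩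
  Zconn singleEdge w * Zsplit (path l′) w + Zsplit singleEdge w * Zconn (path l′) w
    ≡⟨ cong₂ _+_ (cong₂ _*_ (Zconn-singleEdge w) (Zsplit-path l′ w))
                 (cong₂ _*_ (Zsplit-singleEdge w) (Zconn-path l′ w)) ⟩
  w * (ℕtoℚ (suc l′) * w ^ l′) + 1ℚ * (w * w ^ l′)
    ≡⟨ solve 3 (λ w n x → w :* (n :* x) :+ con 1ℚ :* (w :* x) := (con 1ℚ :+ n) :* (w :* x)) refl
               w (ℕtoℚ (suc l′)) (w ^ l′) ⟩
  (1ℚ + ℕtoℚ (suc l′)) * w ^ suc l′                                 ≡⟨ cong (_* w ^ suc l′) (ℕtoℚ-suc (suc l′)) ⟨
  ℕtoℚ (suc (suc l′)) * w ^ suc l′                                  ∎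

-- Inflation

module Inflation (G : Graph) (H : TwoTerminal) (w : ℚ) where
  open BlockSum H w

  private
    anyCol = uniformSubstitution G H (ends (G ⊗ H)) (ends-⊗ G H) AnyColouring anyColouring-resp anyColouring-const

    selected⇔connects : ∀ A e → (Selected (connectingBlocks {m G} A) e → Connects H (blockOf A e)) ×
                                (Connects H (blockOf A e) → Selected (connectingBlocks {m G} A) e)
    selected⇔connects A e = (λ sel → does⇒ (connects? H _) (trans (sym (lookup∘tabulate _ e)) sel)) ,
                            (λ c → trans (lookup∘tabulate _ e) (dec-true (connects? H _) c))

    connectedSub?-⊗ : ∀ A → does (connectedSub? (G ⊗ H) A) ≡
                             allRooted (m G) A ∧ does (connectedSub? G (connectingBlocks {m G} A))
    connectedSub?-⊗ A = does-≡ᵇ (connectedSub? (G ⊗ H) A) _ to from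
      where
      to : ConnectedSub (G ⊗ H) A → allRooted (m G) A ∧ does (connectedSub? G (connectingBlocks {m G} A)) ≡ true
      to c = cong₂ _∧_
        (allᵇ-true (m G) (λ e → dec-true (rooted? H _) (cutConnected⇒rooted anyCol A c′ e)))
        (dec-true (connectedSub? G _) (cutConnected⇒connectedSub G _
          (cutConnected-mono G (λ e → proj₂ (selected⇔connects A e)) (cutConnected⇒base anyCol A c′))))
        where
        c′ = connectedSub⇒cutConnected (G ⊗ H) A c
      from : allRooted (m G) A ∧ does (connectedSub? G (connectingBlocks {m G} A)) ≡ true → ConnectedSub (G ⊗ H) A
      from eq with ∧-true⁻ (allRooted (m G) A) eq
      ... | (rooted , connected) = cutConnected⇒connectedSub (G ⊗ H) A (cutConnected-substitution anyCol A
            (λ e → does⇒ (rooted? H _) (allᵇ-true⁻ (m G) rooted e))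
            (cutConnected-mono G (λ e → proj₁ (selected⇔connects A e))
              (connectedSub⇒cutConnected G _ (does⇒ (connectedSub? G _) connected))))

    isConnected : Subset (m G) → ℚ
    isConnected c = if does (connectedSub? G c) then 1ℚ else 0ℚ

  ZR-⊗ : ∀ wH → Zconn H w ≡ Zsplit H w * wH → ZR (G ⊗ H) w ≡ Zsplit H w ^ m G * ZR G wH
  ZR-⊗ wH T≡NwH = begin
    ZR (G ⊗ H) w
      ≡⟨ sumSubsets-cong (m G ℕ.* q H) (λ A → trans (cong (λ b → if b then w ^ ∣ A ∣ else 0ℚ) (connectedSub?-⊗ A))
           (if-∧-indicator (allRooted (m G) A) (does (connectedSub? G (connectingBlocks {m G} A))) (w ^ ∣ A ∣))) ⟩
    blockSum (m G) isConnected
      ≡⟨ blockSum-weight (m G) isConnected ⟩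
    sumSubsets (m G) (λ c → isConnected c * weight c)
      ≡⟨ sumSubsets-cong (m G) term ⟩
    sumSubsets (m G) (λ c → N ^ m G * (if does (connectedSub? G c) then wH ^ ∣ c ∣ else 0ℚ))
      ≡⟨ sumSubsets-*ˡ (m G) (N ^ m G) _ ⟩
    N ^ m G * ZR G wH ∎
    where
    N = Zsplit H w
    weight≡ : ∀ {k} (c : Subset k) → weight c ≡ N ^ k * wH ^ ∣ c ∣
    weight≡ []          = sym (*-identityˡ 1ℚ)
    weight≡ (true ∷ c)  = trans (cong₂ _*_ T≡NwH (weight≡ c))
      (solve 4 (λ n s a b → (n :* s) :* (a :* b) := (n :* a) :* (s :* b)) refl N wH _ _)
    weight≡ (false ∷ c) = trans (cong (N *_) (weight≡ c)) (sym (*-assoc N _ _))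
    term : ∀ c → isConnected c * weight c ≡ N ^ m G * (if does (connectedSub? G c) then wH ^ ∣ c ∣ else 0ℚ)
    term c rewrite weight≡ c with does (connectedSub? G c)
    ... | true  = *-identityˡ _
    ... | false = trans (*-zeroˡ (N ^ m G * wH ^ ∣ c ∣)) (sym (*-zeroʳ (N ^ m G)))

-- Bounces

anyᵇ : ∀ {k} → Subset k → Bool
anyᵇ []      = false
anyᵇ (b ∷ c) = b ∨ anyᵇ c

anyᵇ-true : ∀ {k} (c : Subset k) i → lookup c i ≡ true → anyᵇ c ≡ true
anyᵇ-true (true ∷ c)  _       _  = refl
anyᵇ-true (false ∷ c) (suc i) eq = anyᵇ-true c i eq

anyᵇ-true⁻ : ∀ {k} (c : Subset k) → anyᵇ c ≡ true → ∃ λ i → lookup c i ≡ true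
anyᵇ-true⁻ (true ∷ c)  _  = zero , refl
anyᵇ-true⁻ (false ∷ c) eq with anyᵇ-true⁻ c eq
... | (i , ci) = suc i , ci

tends-bounce : ∀ h l′ (j : Fin h) (t : Fin (suc l′)) → tends (bounce h (suc l′)) (combine j t) ≡
  (embedUniform (parallelSkeleton h) (path l′) j (pathPos l′ (inject₁ t)) ,
   embedUniform (parallelSkeleton h) (path l′) j (pathPos l′ (suc t)))
tends-bounce h l′ j zero rewrite quotRem-combine {h} {suc l′} j zero with inner l′ zero
... | inj₁ _ = refl
... | inj₂ _ = refl
tends-bounce h l′ j (suc t) rewrite quotRem-combine {h} {suc l′} j (suc t) with inner l′ (inject₁ t) | inner l′ (suc t)
... | inj₁ _ | inj₁ _ = refl
... | inj₁ _ | inj₂ _ = refl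
... | inj₂ _ | inj₁ _ = refl
... | inj₂ _ | inj₂ _ = refl

module Bounce (h l′ : ℕ) (w : ℚ) where
  open BlockSum (path l′) w

  private
    P = path l′
    B = bounce h (suc l′)

    substitution : (Adm : Subset 2 → Set) →
      (∀ X Y → (∀ v → lookup X v ≡ lookup Y v) → Adm X → Adm Y) →
      (∀ X b → (∀ v → lookup X v ≡ b) → Adm X) → Substitution
    substitution = uniformSubstitution (parallelSkeleton h) P (tends B) (tends-bounce h l′)

    anyCol = substitution AnyColouring anyColouring-resp anyColouring-const
    agreeCol = substitution TerminalsAgree terminalsAgree-resp terminalsAgree-const

    connects?-bounce : ∀ A → does (connects? B A) ≡ allRooted h A ∧ anyᵇ (connectingBlocks {h} A)
    connects?-bounce A = does-≡ᵇ (connects? B A) _ to from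
      where
      to : Connects B A → allRooted h A ∧ anyᵇ (connectingBlocks {h} A) ≡ true
      to c with parallelSkeleton-any⇒ (cutConnected⇒base anyCol A c)
      ... | (e , connects) = cong₂ _∧_
        (allᵇ-true h (λ e′ → dec-true (rooted? P _) (cutConnected⇒rooted anyCol A c e′)))
        (anyᵇ-true (connectingBlocks {h} A) e (trans (lookup∘tabulate _ e) (dec-true (connects? P _) connects)))
      from : allRooted h A ∧ anyᵇ (connectingBlocks {h} A) ≡ true → Connects B A
      from eq with ∧-true⁻ (allRooted h A) eq
      ... | (rooted , some) with anyᵇ-true⁻ (connectingBlocks {h} A) some
      ... | (e , connecting) = cutConnected-substitution anyCol A
            (λ e′ → does⇒ (rooted? P _) (allᵇ-true⁻ h rooted e′))
            (parallelSkeleton-any⇐ (e , does⇒ (connects? P _) (trans (sym (lookup∘tabulate _ e)) connecting)))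

    rooted?-bounce : ∀ A → does (rooted? B A) ≡ allRooted h A
    rooted?-bounce A = does-≡ᵇ (rooted? B A) (allRooted h A)
      (λ r → allᵇ-true h (λ e → dec-true (rooted? P _) (cutConnected⇒rooted agreeCol A r e)))
      (λ eq → cutConnected-substitution agreeCol A (λ e → does⇒ (rooted? P _) (allᵇ-true⁻ h eq e)) parallelSkeleton-agree)

    T = Zconn P w
    N = Zsplit P w

    reassoc : ∀ a n x → a * (n * x) ≡ n * (a * x)
    reassoc = solve 3 (λ a n x → a :* (n :* x) := n :* (a :* x)) refl

    some none : ∀ {k} → Subset k → ℚ
    some c = if anyᵇ c then 1ℚ else 0ℚ
    none c = if anyᵇ c then 0ℚ else 1ℚ

    sum-weight : ∀ k → sumSubsets k weight ≡ (T + N) ^ k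
    sum-weight zero    = refl
    sum-weight (suc k) = begin
      sumSubsets k (λ c → T * weight c) + sumSubsets k (λ c → N * weight c)
        ≡⟨ cong₂ _+_ (sumSubsets-*ˡ k T weight) (sumSubsets-*ˡ k N weight) ⟩
      T * sumSubsets k weight + N * sumSubsets k weight
        ≡⟨ cong (λ z → T * z + N * z) (sum-weight k) ⟩
      T * (T + N) ^ k + N * (T + N) ^ k
        ≡⟨ solve 3 (λ t n z → t :* z :+ n :* z := (t :+ n) :* z) refl T N ((T + N) ^ k) ⟩
      (T + N) ^ suc k ∎

    -- Only the empty set of connecting blocks contributes.
    sum-none : ∀ k → sumSubsets k (λ c → none c * weight c) ≡ N ^ k
    sum-none zero    = refl
    sum-none (suc k) = begin
      sumSubsets k (λ c → 0ℚ * (T * weight c)) + sumSubsets k (λ c → none c * (N * weight c))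
        ≡⟨ cong₂ _+_ (trans (sumSubsets-cong k (λ c → *-zeroˡ (T * weight c))) (sumSubsets-0 k))
                     (sumSubsets-cong k (λ c → reassoc (none c) N (weight c))) ⟩
      0ℚ + sumSubsets k (λ c → N * (none c * weight c))
        ≡⟨ +-identityˡ _ ⟩
      sumSubsets k (λ c → N * (none c * weight c))
        ≡⟨ sumSubsets-*ˡ k N _ ⟩
      N * sumSubsets k (λ c → none c * weight c)
        ≡⟨ cong (N *_) (sum-none k) ⟩
      N ^ suc k ∎

    sum-some : ∀ k → sumSubsets k (λ c → some c * weight c) + N ^ k ≡ (T + N) ^ k
    sum-some zero    = +-identityˡ 1ℚ
    sum-some (suc k) = begin
      (sumSubsets k (λ c → 1ℚ * (T * weight c)) + sumSubsets k (λ c → some c * (N * weight c))) + N * N ^ k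
        ≡⟨ cong (_+ N * N ^ k) (cong₂ _+_
             (trans (sumSubsets-cong k (λ c → *-identityˡ (T * weight c))) (sumSubsets-*ˡ k T weight))
             (trans (sumSubsets-cong k (λ c → reassoc (some c) N (weight c))) (sumSubsets-*ˡ k N _))) ⟩
      (T * sumSubsets k weight + N * S) + N * N ^ k
        ≡⟨ solve 5 (λ t n w s z → (t :* w :+ n :* s) :+ n :* z := t :* w :+ n :* (s :+ z)) refl
                   T N (sumSubsets k weight) S (N ^ k) ⟩
      T * sumSubsets k weight + N * (S + N ^ k)
        ≡⟨ cong₂ (λ x y → T * x + N * y) (sum-weight k) (sum-some k) ⟩
      T * (T + N) ^ k + N * (T + N) ^ k
        ≡⟨ solve 3 (λ t n z → t :* z :+ n :* z := (t :+ n) :* z) refl T N ((T + N) ^ k) ⟩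
      (T + N) ^ suc k ∎
      where
      S = sumSubsets k (λ c → some c * weight c)

    if-∧-not : ∀ a b (x : ℚ) → (if a ∧ not (a ∧ b) then x else 0ℚ) ≡ (if a then (if b then 0ℚ else 1ℚ) else 0ℚ) * x
    if-∧-not true  true  x = sym (*-zeroˡ x)
    if-∧-not true  false x = sym (*-identityˡ x)
    if-∧-not false b     x = sym (*-zeroˡ x)

  Zconn-bounce : Zconn (bounce h (suc l′)) w ≡ (Zconn (path l′) w + Zsplit (path l′) w) ^ h - Zsplit (path l′) w ^ h
  Zconn-bounce = begin
    Zconn B w
      ≡⟨ sumSubsets-cong (h ℕ.* suc l′) (λ A → trans (cong (λ b → if b then w ^ ∣ A ∣ else 0ℚ) (connects?-bounce A))
                                                    (if-∧-indicator (allRooted h A) (anyᵇ (connectingBlocks {h} A)) (w ^ ∣ A ∣))) ⟩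
    blockSum h some
      ≡⟨ blockSum-weight h some ⟩
    sumSubsets h (λ c → some c * weight c)
      ≡⟨ solve 2 (λ s z → s := (s :+ z) :- z) refl _ (N ^ h) ⟩
    (sumSubsets h (λ c → some c * weight c) + N ^ h) - N ^ h
      ≡⟨ cong (_- N ^ h) (sum-some h) ⟩
    (T + N) ^ h - N ^ h ∎

  Zsplit-bounce : Zsplit (bounce h (suc l′)) w ≡ Zsplit (path l′) w ^ h
  Zsplit-bounce = begin
    Zsplit B w
      ≡⟨ sumSubsets-cong (h ℕ.* suc l′) (λ A → trans
           (cong₂ (λ r c → if r ∧ not c then w ^ ∣ A ∣ else 0ℚ) (rooted?-bounce A) (connects?-bounce A))
           (if-∧-not (allRooted h A) (anyᵇ (connectingBlocks {h} A)) (w ^ ∣ A ∣))) ⟩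
    blockSum h none
      ≡⟨ blockSum-weight h none ⟩
    sumSubsets h (λ c → none c * weight c)
      ≡⟨ sum-none h ⟩
    N ^ h ∎

bounceConn : ℚ → ℕ → ℕ → ℚ
bounceConn w i s = w ^ ((s ℕ.∸ 1) ℕ.* i) * ((w + ℕtoℚ s) ^ i - ℕtoℚ s ^ i)

bounceRatio : ℚ → ℕ → ℕ → ℚ
bounceRatio w i s = inv ((1ℚ + w * inv (ℕtoℚ s)) ^ i - 1ℚ)

module _ (w : ℚ) (l′ : ℕ) where
  private
    s = ℕtoℚ (suc l′)
    x = w ^ l′

  Zconn-bounce-path : ∀ i → Zconn (bounce i (suc l′)) w ≡ (w * x + s * x) ^ i - (s * x) ^ i
  Zconn-bounce-path i = trans (Bounce.Zconn-bounce i l′ w)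
    (cong₂ (λ t n → (t + n) ^ i - n ^ i) (Zconn-path l′ w) (Zsplit-path l′ w))

  Zconn-bounce-closed : ∀ i → Zconn (bounce i (suc l′)) w ≡ bounceConn w i (suc l′)
  Zconn-bounce-closed i = begin
    Zconn (bounce i (suc l′)) w
      ≡⟨ Zconn-bounce-path i ⟩
    (w * x + s * x) ^ i - (s * x) ^ i
      ≡⟨ cong₂ (λ a b → a ^ i - b ^ i) (solve 3 (λ w s x → w :* x :+ s :* x := x :* (w :+ s)) refl w s x) (*-comm s x) ⟩
    (x * (w + s)) ^ i - (x * s) ^ i
      ≡⟨ cong₂ _-_ (^-distrib-* x (w + s) i) (^-distrib-* x s i) ⟩
    x ^ i * (w + s) ^ i - x ^ i * s ^ i
      ≡⟨ solve 3 (λ a b c → a :* b :- a :* c := a :* (b :- c)) refl (x ^ i) ((w + s) ^ i) (s ^ i) ⟩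
    x ^ i * ((w + s) ^ i - s ^ i)
      ≡⟨ cong (_* ((w + s) ^ i - s ^ i)) (^-* w l′ i) ⟨
    bounceConn w i (suc l′) ∎

  module _ (0<w : 0ℚ <ℚ w) (i′ : ℕ) where
    private
      i = suc i′
      y = w * inv s
      N = (s * x) ^ i

      0<y : 0ℚ <ℚ y
      0<y = pos-* 0<w (pos-inv (pos-ℕtoℚ l′))

      0<c : 0ℚ <ℚ (1ℚ + y) ^ i - 1ℚ
      0<c = subst (0ℚ <ℚ_) (sym (^-1-geometric y i′)) (pos-* 0<y (pos-geometricSum i′ 0<y))

    pos-bounceRatio : 0ℚ <ℚ bounceRatio w i (suc l′)
    pos-bounceRatio = pos-inv 0<c

    Zsplit-bounce-ratio : Zsplit (bounce i (suc l′)) w ≡ bounceRatio w i (suc l′) * Zconn (bounce i (suc l′)) w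
    Zsplit-bounce-ratio = begin
      Zsplit (bounce i (suc l′)) w
        ≡⟨ trans (Bounce.Zsplit-bounce i l′ w) (cong (_^ i) (Zsplit-path l′ w)) ⟩
      N
        ≡⟨ inv-cancel (≢-sym (<⇒≢ 0<c)) N·c ⟩
      bounceRatio w i (suc l′) * ((w * x + s * x) ^ i - N)
        ≡⟨ cong (bounceRatio w i (suc l′) *_) (Zconn-bounce-path i) ⟨
      bounceRatio w i (suc l′) * Zconn (bounce i (suc l′)) w ∎
      where
      N·c : N * ((1ℚ + y) ^ i - 1ℚ) ≡ (w * x + s * x) ^ i - N
      N·c = begin
        N * ((1ℚ + y) ^ i - 1ℚ)
          ≡⟨ solve 2 (λ a b → a :* (b :- con 1ℚ) := a :* b :- a) refl N ((1ℚ + y) ^ i) ⟩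
        N * (1ℚ + y) ^ i - N
          ≡⟨ cong (_- N) (^-distrib-* (s * x) (1ℚ + y) i) ⟨
        (s * x * (1ℚ + y)) ^ i - N
          ≡⟨ cong (λ z → z ^ i - N) (solve 4 (λ s x w v → s :* x :* (con 1ℚ :+ w :* v) := w :* x :* (s :* v) :+ s :* x)
                                             refl s x w (inv s)) ⟩
        (w * x * (s * inv s) + s * x) ^ i - N
          ≡⟨ cong (λ z → (w * x * z + s * x) ^ i - N) (inv-inverseʳ s (≢-sym (<⇒≢ (pos-ℕtoℚ l′)))) ⟩
        (w * x * 1ℚ + s * x) ^ i - N
          ≡⟨ cong (λ z → (z + s * x) ^ i - N) (*-identityʳ (w * x)) ⟩
        (w * x + s * x) ^ i - N ∎

module _ (w : ℚ) where

  Zconn-bounceFrom : ∀ i s ss → 1 < s → List.All (1 <_) ss →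
    Zconn (bounceFrom i s ss) w ≡ prodIdx (bounceConn w) i (s ∷ ss)
  Zconn-bounceFrom i (suc l′) [] _ List.[] =
    trans (Zconn-bounce-closed w l′ i) (sym (*-identityʳ (bounceConn w i (suc l′))))
  Zconn-bounceFrom i (suc l′) (s′ ∷ ss) _ (1<s′ List.∷ 1<ss) = begin
    Zconn (series (bounce i (suc l′)) (bounceFrom (suc i) s′ ss)) w
      ≡⟨ Series.Zconn-series (bounce i (suc l′)) (bounceFrom (suc i) s′ ss) w ⟩
    Zconn (bounce i (suc l′)) w * Zconn (bounceFrom (suc i) s′ ss) w
      ≡⟨ cong₂ _*_ (Zconn-bounce-closed w l′ i) (Zconn-bounceFrom (suc i) s′ ss 1<s′ 1<ss) ⟩
    prodIdx (bounceConn w) i (suc l′ ∷ s′ ∷ ss) ∎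

  module _ (0<w : 0ℚ <ℚ w) where

    pos-sumIdx-bounceRatio : ∀ i′ s ss → 1 < s → List.All (1 <_) ss →
      0ℚ <ℚ sumIdx (bounceRatio w) (suc i′) (s ∷ ss)
    pos-sumIdx-bounceRatio i′ (suc l′) [] _ List.[] =
      subst (0ℚ <ℚ_) (sym (+-identityʳ (bounceRatio w (suc i′) (suc l′)))) (pos-bounceRatio w l′ 0<w i′)
    pos-sumIdx-bounceRatio i′ (suc l′) (s′ ∷ ss) _ (1<s′ List.∷ 1<ss) =
      pos-+ (pos-bounceRatio w l′ 0<w i′) (pos-sumIdx-bounceRatio (suc i′) s′ ss 1<s′ 1<ss)

    -- Zsplit is a derivation for series composition, so the ratios Zsplit / Zconn add up.
    Zsplit-bounceFrom : ∀ i′ s ss → 1 < s → List.All (1 <_) ss →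
      Zsplit (bounceFrom (suc i′) s ss) w ≡
      sumIdx (bounceRatio w) (suc i′) (s ∷ ss) * Zconn (bounceFrom (suc i′) s ss) w
    Zsplit-bounceFrom i′ (suc l′) [] _ List.[] =
      trans (Zsplit-bounce-ratio w l′ 0<w i′)
            (cong (_* Zconn (bounce (suc i′) (suc l′)) w) (sym (+-identityʳ (bounceRatio w (suc i′) (suc l′)))))
    Zsplit-bounceFrom i′ (suc l′) (s′ ∷ ss) _ (1<s′ List.∷ 1<ss) = begin
      Zsplit (series b r) w
        ≡⟨ Series.Zsplit-series b r w ⟩
      Zconn b w * Zsplit r w + Zsplit b w * Zconn r w
        ≡⟨ cong₂ (λ n₂ n₁ → Zconn b w * n₂ + n₁ * Zconn r w)
                 (Zsplit-bounceFrom (suc i′) s′ ss 1<s′ 1<ss) (Zsplit-bounce-ratio w l′ 0<w i′) ⟩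
      Zconn b w * (ρᵣ * Zconn r w) + (ρ * Zconn b w) * Zconn r w
        ≡⟨ solve 4 (λ t₁ t₂ a b → t₁ :* (b :* t₂) :+ (a :* t₁) :* t₂ := (a :+ b) :* (t₁ :* t₂)) refl
                   (Zconn b w) (Zconn r w) ρ ρᵣ ⟩
      (ρ + ρᵣ) * (Zconn b w * Zconn r w)
        ≡⟨ cong ((ρ + ρᵣ) *_) (Series.Zconn-series b r w) ⟨
      (ρ + ρᵣ) * Zconn (series b r) w ∎
      where
      b = bounce (suc i′) (suc l′)
      r = bounceFrom (suc (suc i′)) s′ ss
      ρ = bounceRatio w (suc i′) (suc l′)
      ρᵣ = sumIdx (bounceRatio w) (suc (suc i′)) (s′ ∷ ss)

lemma4 : (G : Graph) → Connected G →
         (S : List⁺ ℕ) → All (λ s → 1 < s) S →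
         (w : ℚ) → 0ℚ <ℚ w →
         ZR (G ⊗ bounceGraph S) w ≡ (CS S w ^ m G) *ℚ ZR G (wS S w)
lemma4 G _ S@(s ∷ ss) (1<s ∷ 1<ss) w 0<w = begin
  ZR (G ⊗ B) w                      ≡⟨ Inflation.ZR-⊗ G B w (wS S w) Zconn≡Zsplit·wS ⟩
  Zsplit B w ^ m G * ZR G (wS S w)  ≡⟨ cong (λ c → c ^ m G * ZR G (wS S w)) Zsplit≡CS ⟩
  CS S w ^ m G * ZR G (wS S w)      ∎
  where
  B = bounceGraph S
  ρ = invWS S w
  Zsplit≡ρZconn : Zsplit B w ≡ ρ * Zconn B w
  Zsplit≡ρZconn = Zsplit-bounceFrom w 0<w 0 s ss 1<s 1<ss
  Zsplit≡CS : Zsplit B w ≡ CS S w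
  Zsplit≡CS = trans Zsplit≡ρZconn (cong (ρ *_) (Zconn-bounceFrom w 1 s ss 1<s 1<ss))
  Zconn≡Zsplit·wS : Zconn B w ≡ Zsplit B w * wS S w
  Zconn≡Zsplit·wS = trans (inv-cancel (≢-sym (<⇒≢ (pos-sumIdx-bounceRatio w 0<w 0 s ss 1<s 1<ss)))
                                      (trans (*-comm (Zconn B w) ρ) (sym Zsplit≡ρZconn)))
                          (*-comm (wS S w) (Zsplit B w))
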